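{- Let $\Sigma$ be a finite alphabet and $e,f\in\mathrm{RegE}(\Sigma)$. If $e\le f$ is derivable in $\mathsf{SRKAM}$, then $e\le f$ is valid in the extended Weihrauch degrees, i.e. $[\![e]\!]_\rho\le_W[\![f]\!]_\rho$ for every interpretation $\rho$ of $\Sigma$ by extended Weihrauch problems.
   Context: Coding: fix a computable tupling $\langle\cdots\rangle$ on $\mathbb{N}^\mathbb{N}$, computable injections $\mathsf{in}_1,\mathsf{in}_2$ with disjoint decidable images, a computable point $\bullet$, and $\mathcal K_2$-application $c\cdot x$ ("$c\cdot x\in A$" includes definedness). An extended Weihrauch problem $P$ is a set $\mathrm{dom}(P)\subseteq\mathbb{N}^\mathbb{N}$ with possibly empty solution sets $P(u)\subseteq\mathbb{N}^\mathbb{N}$ for $u\in\mathrm{dom}(P)$. $P\le_W Q$ iff there are computable partial $\varphi,\psi$ with $\varphi(u)\in\mathrm{dom}(Q)$ for $u\in\mathrm{dom}(P)$ and $\psi(u,y)\in P(u)$ for $y\in Q(\varphi(u))$. Operations: $\mathrm{dom}(0)=\emptyset$; $\mathrm{dom}(\top)=\{\bullet\},\top(\bullet)=\emptyset$; $\mathrm{dom}(1)=\{\bullet\},1(\bullet)=\{\bullet\}$; $P\sqcup Q$: instances $\mathsf{in}_1(u)$ / $\mathsf{in}_2(v)$ with solutions $P(u)$ / $Q(v)$; $P\sqcap Q$: instances $\langle u,v\rangle$, solutions $\{\mathsf{in}_1(x):x\in P(u)\}\cup\{\mathsf{in}_2(y):y\in Q(v)\}$; $P\star Q$: instances $\langle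 u,c\rangle$ with $u\in\mathrm{dom}(Q)$ and $c\cdot x\in\mathrm{dom}(P)$ for all $x\in Q(u)$, solutions $\{\langle x,y\rangle:x\in Q(u),y\in P(c\cdot x)\}$; $\mathrm{dom}(P^\diamond)$ least $D$ with $\bullet\in D$ and $\langle u,c\rangle\in D$ whenever $u\in\mathrm{dom}(P)$ and $c\cdot x\in D$ for all $x\in P(u)$; $P^\diamond(\bullet)=\{\bullet\}$, $P^\diamond(\langle u,c\rangle)=\{\langle x,y\rangle:x\in P(u),y\in P^\diamond(c\cdot x)\}$. $\mathrm{RegE}(\Sigma)$: $e::=a\ (a\in\Sigma)\mid0\mid\top\mid1\mid e\sqcup e\mid e\sqcap e\mid e\star e\mid e^\diamond$; $[\![\cdot]\!]_\rho$ extends $\rho$ compositionally. $\mathsf{SRKAM}$: reflexivity $a\le a$ and the following axiom schemes / Horn rules for arbitrary expressions $a,b,c,a',b'$ ($a=b$ abbreviates both inequalities): $a\le b\wedge b\le c\Rightarrow a\le c$; $0\le a$; $a\le\top$; $a\le a\sqcup b$; $b\le a\sqcup b$; $b\le a\wedge c\le a\Rightarrow b\sqcup c\le a$; $a\sqcap b\le a$; $a\sqcap b\le b$; $a\le b\wedge a\le c\Rightarrow a\le b\sqcap c$; $a\sqcap(b\sqcup c)\le(a\sqcap b)\sqcup(a\sqcap c)$; $a\star1=a=1\star a$; $a\star(b\star c)=(a\star b)\star c$; $a\le a'\wedge b\le b'\Rightarrow a\star b\le a'\star b'$; $a\star0\le0$; $\top\le a\star\top$; $a\star(b\sqcup c)\le(a\star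 b)\sqcup(a\star c)$; $(a\star b)\sqcap(a\star c)\le a\star(b\sqcap c)$; $(a\star b)\sqcap c\le(a\sqcap c)\star b$; $1\le a^\diamond$; $a^\diamond\star a\le a^\diamond$; $a\sqcap(b\star c)\le b\Rightarrow a\sqcap(b\star c^\diamond)\le b$. -}

module Defs where

open import Data.Nat using (ℕ; zero; suc; _+_; _<_)
open import Data.Fin using (Fin)
open import Data.Vec using (Vec; []; _∷_; lookup)
open import Data.List using (List; []; _∷_)
open import Data.Product using (Σ; _×_; _,_)
open import Data.Sum using (_⊎_)
open import Data.Empty using (⊥)
open import Relation.Binary.PropositionalEquality using (_≡_)

Baire : Set
Baire = ℕ → ℕ

infix 4 _≈_
_≈_ : Baire → Baire → Set
u ≈ v = ∀ n → u n ≡ v n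

data PR : ℕ → Set where
  zeroF : {n : ℕ} → PR n
  succF : PR 1
  projF : {n : ℕ} → Fin n → PR n
  compF : {m n : ℕ} → PR m → Vec (PR n) m → PR n
  recF  : {n : ℕ} → PR n → PR (suc (suc n)) → PR (suc n)
  muF   : {n : ℕ} → PR (suc n) → PR n

data Eval : {n : ℕ} → PR n → Vec ℕ n → ℕ → Set
data EvalAll : {n m : ℕ} → Vec (PR n) m → Vec ℕ n → Vec ℕ m → Set

data Eval where
  ev-zero : {n : ℕ} {xs : Vec ℕ n} → Eval zeroF xs 0
  ev-succ : {x : ℕ} → Eval succF (x ∷ []) (suc x)
  ev-proj : {n : ℕ} {i : Fin n} {xs : Vec ℕ n} → Eval (projF i) xs (lookup xs i)
  ev-comp : {m n : ℕ} {f : PR m} {gs : Vec (PR n) m} {xs : Vec ℕ n} {ys : Vec ℕ m} {y : ℕ} →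
            EvalAll gs xs ys → Eval f ys y → Eval (compF f gs) xs y
  ev-rec0 : {n : ℕ} {g : PR n} {h : PR (suc (suc n))} {xs : Vec ℕ n} {y : ℕ} →
            Eval g xs y → Eval (recF g h) (0 ∷ xs) y
  ev-recS : {n : ℕ} {g : PR n} {h : PR (suc (suc n))} {xs : Vec ℕ n} {k r y : ℕ} →
            Eval (recF g h) (k ∷ xs) r → Eval h (k ∷ r ∷ xs) y → Eval (recF g h) (suc k ∷ xs) y
  ev-mu   : {n : ℕ} {f : PR (suc n)} {xs : Vec ℕ n} {k : ℕ} →
            Eval f (k ∷ xs) 0 → (∀ j → j < k → Σ ℕ (λ m → Eval f (j ∷ xs) (suc m))) →
            Eval (muF f) xs k

data EvalAll where
  []  : {n : ℕ} {xs : Vec ℕ n} → EvalAll [] xs []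
  _∷_ : {n m : ℕ} {g : PR n} {gs : Vec (PR n) m} {xs : Vec ℕ n} {y : ℕ} {ys : Vec ℕ m} →
        Eval g xs y → EvalAll gs xs ys → EvalAll (g ∷ gs) xs (y ∷ ys)

Computable : Baire → Set
Computable x = Σ (PR 1) (λ e → ∀ n → Eval e (n ∷ []) (x n))

tri : ℕ → ℕ
tri zero = zero
tri (suc n) = suc n + tri n

cantor : ℕ → ℕ → ℕ
cantor x y = tri (x + y) + y

code : List ℕ → ℕ
code [] = 0
code (x ∷ xs) = suc (cantor x (code xs))

prefix : Baire → ℕ → List ℕ
prefix β zero = []
prefix β (suc k) = β 0 ∷ prefix (λ n → β (suc n)) k

Out : (List ℕ → ℕ) → Baire → ℕ → Set
Out γ β m = Σ ℕ (λ k → (γ (prefix β k) ≡ suc m) × (∀ j → j < k → γ (prefix β j) ≡ 0))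

-- App α β y  means: α · β is defined and equals y
App : Baire → Baire → Baire → Set
App α β y = ∀ n → Out (λ s → α (code (n ∷ s))) β (y n)

cons : ℕ → Baire → Baire
cons a u zero = a
cons a u (suc n) = u n

bullet : Baire
bullet _ = 0

in₁ : Baire → Baire
in₁ = cons 0

in₂ : Baire → Baire
in₂ = cons 1

interleave : Baire → Baire → Baire
interleave u v zero = u 0
interleave u v (suc zero) = v 0
interleave u v (suc (suc n)) = interleave (λ k → u (suc k)) (λ k → v (suc k)) n

-- tagged so that bullet is never a pair
pair : Baire → Baire → Baire
pair u v = cons 1 (interleave u v)

record Problem : Set₁ where
  field
    Dom : Baire → Set
    Sol : Baire → Baire → Set
open Problem public

-- subsets of ℕ^ℕ: membership invariant under pointwise equality
Extensional : Problem → Set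
Extensional P =
  (∀ u u' → u ≈ u' → Dom P u → Dom P u') ×
  (∀ u u' x x' → u ≈ u' → x ≈ x' → Sol P u x → Sol P u' x')

infix 4 _≤W_
_≤W_ : Problem → Problem → Set
P ≤W Q = Σ Baire λ c → Σ Baire λ d → Computable c × Computable d ×
  (∀ u → Dom P u → Σ Baire λ v → App c u v × Dom Q v ×
     (∀ y → Sol Q v y → Σ Baire λ z → App d (pair u y) z × Sol P u z))

𝟘P : Problem
𝟘P = record { Dom = λ _ → ⊥ ; Sol = λ _ _ → ⊥ }

⊤P : Problem
⊤P = record { Dom = λ u → u ≈ bullet ; Sol = λ _ _ → ⊥ }

𝟙P : Problem
𝟙P = record { Dom = λ u → u ≈ bullet ; Sol = λ _ x → x ≈ bullet }

_⊔P_ : Problem → Problem → Problem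
P ⊔P Q = record
  { Dom = λ w → (Σ Baire λ u → w ≈ in₁ u × Dom P u) ⊎ (Σ Baire λ v → w ≈ in₂ v × Dom Q v)
  ; Sol = λ w z → (Σ Baire λ u → w ≈ in₁ u × Sol P u z) ⊎ (Σ Baire λ v → w ≈ in₂ v × Sol Q v z)
  }

_⊓P_ : Problem → Problem → Problem
P ⊓P Q = record
  { Dom = λ w → Σ Baire λ u → Σ Baire λ v → w ≈ pair u v × Dom P u × Dom Q v
  ; Sol = λ w z → Σ Baire λ u → Σ Baire λ v → w ≈ pair u v ×
      ((Σ Baire λ x → z ≈ in₁ x × Sol P u x) ⊎ (Σ Baire λ y → z ≈ in₂ y × Sol Q v y))
  }

_⋆P_ : Problem → Problem → Problem
P ⋆P Q = record
  { Dom = λ w → Σ Baire λ u → Σ Baire λ c → w ≈ pair u c × Dom Q u ×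
      (∀ x → Sol Q u x → Σ Baire λ v → App c x v × Dom P v)
  ; Sol = λ w z → Σ Baire λ u → Σ Baire λ c → w ≈ pair u c ×
      (Σ Baire λ x → Σ Baire λ y → Σ Baire λ v →
         z ≈ pair x y × Sol Q u x × App c x v × Sol P v y)
  }

data DomD (P : Problem) : Baire → Set where
  leaf : ∀ w → w ≈ bullet → DomD P w
  node : ∀ w u c → w ≈ pair u c → Dom P u →
         (∀ x → Sol P u x → Σ Baire λ v → App c x v × DomD P v) → DomD P w

data SolD (P : Problem) : Baire → Baire → Set where
  leafS : ∀ w z → w ≈ bullet → z ≈ bullet → SolD P w z
  nodeS : ∀ w z u c x v y → w ≈ pair u c → Sol P u x → App c x v → SolD P v y →
          z ≈ pair x y → SolD P w z

_◇P : Problem → Problem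
P ◇P = record { Dom = DomD P ; Sol = SolD P }

infixl 6 _∨_
infixl 7 _∧_
infixl 8 _⋆_
infix 9 _◇

data RegE (n : ℕ) : Set where
  var : Fin n → RegE n
  𝟎 𝐓 𝟏 : RegE n
  _∨_ _∧_ _⋆_ : RegE n → RegE n → RegE n
  _◇ : RegE n → RegE n

⟦_⟧ : {n : ℕ} → RegE n → (Fin n → Problem) → Problem
⟦ var a ⟧ ρ = ρ a
⟦ 𝟎 ⟧ ρ = 𝟘P
⟦ 𝐓 ⟧ ρ = ⊤P
⟦ 𝟏 ⟧ ρ = 𝟙P
⟦ e ∨ f ⟧ ρ = ⟦ e ⟧ ρ ⊔P ⟦ f ⟧ ρ
⟦ e ∧ f ⟧ ρ = ⟦ e ⟧ ρ ⊓P ⟦ f ⟧ ρ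
⟦ e ⋆ f ⟧ ρ = ⟦ e ⟧ ρ ⋆P ⟦ f ⟧ ρ
⟦ e ◇ ⟧ ρ = ⟦ e ⟧ ρ ◇P

infix 4 _⊢_≤_
data _⊢_≤_ (n : ℕ) : RegE n → RegE n → Set where
  refl≤   : ∀ {a} → n ⊢ a ≤ a
  trans≤  : ∀ {a b c} → n ⊢ a ≤ b → n ⊢ b ≤ c → n ⊢ a ≤ c
  zero≤   : ∀ {a} → n ⊢ 𝟎 ≤ a
  ≤top    : ∀ {a} → n ⊢ a ≤ 𝐓
  inl≤    : ∀ {a b} → n ⊢ a ≤ a ∨ b
  inr≤    : ∀ {a b} → n ⊢ b ≤ a ∨ b
  join≤   : ∀ {a b c} → n ⊢ b ≤ a → n ⊢ c ≤ a → n ⊢ b ∨ c ≤ a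
  meetl   : ∀ {a b} → n ⊢ a ∧ b ≤ a
  meetr   : ∀ {a b} → n ⊢ a ∧ b ≤ b
  meet≤   : ∀ {a b c} → n ⊢ a ≤ b → n ⊢ a ≤ c → n ⊢ a ≤ b ∧ c
  distr   : ∀ {a b c} → n ⊢ a ∧ (b ∨ c) ≤ (a ∧ b) ∨ (a ∧ c)
  unitr₁  : ∀ {a} → n ⊢ a ⋆ 𝟏 ≤ a
  unitr₂  : ∀ {a} → n ⊢ a ≤ a ⋆ 𝟏
  unitl₁  : ∀ {a} → n ⊢ 𝟏 ⋆ a ≤ a
  unitl₂  : ∀ {a} → n ⊢ a ≤ 𝟏 ⋆ a
  assoc₁  : ∀ {a b c} → n ⊢ a ⋆ (b ⋆ c) ≤ (a ⋆ b) ⋆ c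
  assoc₂  : ∀ {a b c} → n ⊢ (a ⋆ b) ⋆ c ≤ a ⋆ (b ⋆ c)
  mono⋆   : ∀ {a b a' b'} → n ⊢ a ≤ a' → n ⊢ b ≤ b' → n ⊢ a ⋆ b ≤ a' ⋆ b'
  annih   : ∀ {a} → n ⊢ a ⋆ 𝟎 ≤ 𝟎
  top⋆    : ∀ {a} → n ⊢ 𝐓 ≤ a ⋆ 𝐓
  distr⋆  : ∀ {a b c} → n ⊢ a ⋆ (b ∨ c) ≤ (a ⋆ b) ∨ (a ⋆ c)
  meet⋆   : ∀ {a b c} → n ⊢ (a ⋆ b) ∧ (a ⋆ c) ≤ a ⋆ (b ∧ c)
  exch    : ∀ {a b c} → n ⊢ (a ⋆ b) ∧ c ≤ (a ∧ c) ⋆ b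
  unit◇   : ∀ {a} → n ⊢ 𝟏 ≤ a ◇
  unfold◇ : ∀ {a} → n ⊢ a ◇ ⋆ a ≤ a ◇
  ind◇    : ∀ {a b c} → n ⊢ a ∧ (b ⋆ c) ≤ b → n ⊢ a ∧ (b ⋆ c ◇) ≤ b

{-# OPTIONS --safe #-}
module Submission where

-- Every SRKAM rule is validated by a Weihrauch reduction whose forward and
-- backward maps are closed terms of Kleene's second algebra K2, i.e. terms built
-- from computable points by K2-application.  Such terms denote computable points
-- because application preserves computability, and K2 has computable
-- combinators 𝐊 and 𝐒, so terms admit λ-abstraction and a fixed-point operator.
-- The fixed point realises the ◇-induction rule by recursion along the
-- well-founded tree of an instance of R◇.  The combinators themselves are
-- μ-recursive neighbourhood functions that simulate K2-application on finite
-- prefixes.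

open import Defs
open import Data.Nat using (ℕ; zero; suc; _+_; _∸_; _≤_; _<_; z≤n; s≤s; pred)
open import Data.Nat.Properties
open import Data.Fin using (Fin; zero; suc; _↑ʳ_)
open import Data.Vec using (Vec; []; _∷_; _++_; lookup; tabulate; tail)
open import Data.Vec.Properties using (tabulate∘lookup)
open import Data.Product using (Σ; _×_; _,_; proj₁; proj₂)
open import Data.Sum using (_⊎_; inj₁; inj₂; map)
open import Data.Empty using (⊥; ⊥-elim)
open import Data.List using ([]; _∷_)
open import Relation.Nullary using (yes; no)
open import Relation.Binary using (tri<; tri≈; tri>)
open import Relation.Binary.PropositionalEquality

record IsPR {k : ℕ} (f : Vec ℕ k → ℕ) : Set where
  constructor mkPR
  field
    prog : PR k
    ev : ∀ xs → Eval prog xs (f xs)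
open IsPR public

isPR-resp : ∀ {k} {f g : Vec ℕ k → ℕ} → (∀ xs → f xs ≡ g xs) → IsPR f → IsPR g
isPR-resp e (mkPR p h) = mkPR p (λ xs → subst (Eval p xs) (e xs) (h xs))

zero-pr : ∀ {k} → IsPR {k} (λ _ → 0)
zero-pr = mkPR zeroF (λ _ → ev-zero)

proj-pr : ∀ {k} (i : Fin k) → IsPR (λ xs → lookup xs i)
proj-pr i = mkPR (projF i) (λ xs → ev-proj)

data AllPR {k : ℕ} : {m : ℕ} → Vec (Vec ℕ k → ℕ) m → Set where
  [] : AllPR []
  _∷_ : ∀ {m g} {gs : Vec (Vec ℕ k → ℕ) m} → IsPR g → AllPR gs → AllPR (g ∷ gs)

applyEach : ∀ {k m} → Vec (Vec ℕ k → ℕ) m → Vec ℕ k → Vec ℕ m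
applyEach [] xs = []
applyEach (g ∷ gs) xs = g xs ∷ applyEach gs xs

programs : ∀ {k m} {gs : Vec (Vec ℕ k → ℕ) m} → AllPR gs → Vec (PR k) m
programs [] = []
programs (p ∷ ps) = prog p ∷ programs ps

evalEach : ∀ {k m} {gs : Vec (Vec ℕ k → ℕ) m} (ps : AllPR gs) → ∀ xs → EvalAll (programs ps) xs (applyEach gs xs)
evalEach [] xs = []
evalEach (p ∷ ps) xs = ev p xs ∷ evalEach ps xs

comp-pr : ∀ {k m} {f : Vec ℕ m → ℕ} {gs : Vec (Vec ℕ k → ℕ) m} → IsPR f → AllPR gs → IsPR (λ xs → f (applyEach gs xs))
comp-pr {gs = gs} pf ps = mkPR (compF (prog pf) (programs ps)) (λ xs → ev-comp (evalEach ps xs) (ev pf (applyEach gs xs)))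

natrec : ∀ {k} → (Vec ℕ k → ℕ) → (Vec ℕ (suc (suc k)) → ℕ) → Vec ℕ (suc k) → ℕ
natrec g h (zero ∷ xs) = g xs
natrec g h (suc n ∷ xs) = h (n ∷ natrec g h (n ∷ xs) ∷ xs)

rec-pr : ∀ {k} {g : Vec ℕ k → ℕ} {h : Vec ℕ (suc (suc k)) → ℕ} → IsPR g → IsPR h → IsPR (natrec g h)
rec-pr {g = g} {h} pg ph = mkPR (recF (prog pg) (prog ph)) go
  where
  go : ∀ xs → Eval (recF (prog pg) (prog ph)) xs (natrec g h xs)
  go (zero ∷ xs) = ev-rec0 (ev pg xs)
  go (suc n ∷ xs) = ev-recS (go (n ∷ xs)) (ev ph _)

IsSuc : ℕ → Set
IsSuc n = Σ ℕ λ r → n ≡ suc r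

mu-pr : ∀ {k} {f : Vec ℕ (suc k) → ℕ} {m : Vec ℕ k → ℕ} → IsPR f →
        (∀ xs → f (m xs ∷ xs) ≡ 0) → (∀ xs j → j < m xs → IsSuc (f (j ∷ xs))) → IsPR m
mu-pr pf z nz = mkPR (muF (prog pf)) (λ xs → ev-mu (subst (Eval (prog pf) _) (z xs) (ev pf _))
   (λ j j< → proj₁ (nz xs j j<) , subst (Eval (prog pf) _) (proj₂ (nz xs j j<)) (ev pf _)))

tabulate-pr : ∀ {k m} (g : Fin m → Vec ℕ k → ℕ) → (∀ i → IsPR (g i)) → AllPR (tabulate g)
tabulate-pr {m = zero} g h = []
tabulate-pr {m = suc m} g h = h zero ∷ tabulate-pr (λ i → g (suc i)) (λ i → h (suc i))

applyEach-tabulate : ∀ {k m} (g : Fin m → Vec ℕ k → ℕ) xs → applyEach (tabulate g) xs ≡ tabulate (λ i → g i xs)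
applyEach-tabulate {m = zero} g xs = refl
applyEach-tabulate {m = suc m} g xs = cong (g zero xs ∷_) (applyEach-tabulate (λ i → g (suc i)) xs)

tail-pr : ∀ {k} {b : Vec ℕ k → ℕ} → IsPR b → IsPR (λ v → b (tail v))
tail-pr {k} {b} pb = isPR-resp eq (comp-pr pb (tabulate-pr (λ i v → lookup v (suc i)) (λ i → proj-pr (suc i))))
  where
  eq : ∀ v → b (applyEach (tabulate (λ i v → lookup v (suc i))) v) ≡ b (tail v)
  eq (x ∷ xs) = cong b (trans (applyEach-tabulate (λ i v → lookup v (suc i)) (x ∷ xs)) (tabulate∘lookup xs))

PRFn : ℕ → Set
PRFn m = Σ (Vec ℕ m → ℕ) IsPR

data Expr (k : ℕ) : Set where
  arg : Fin k → Expr k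
  lit : ℕ → Expr k
  call : ∀ {m} → PRFn m → Vec (Expr k) m → Expr k

mutual
  ⟦_⟧ᵉ : ∀ {k} → Expr k → Vec ℕ k → ℕ
  ⟦ arg i ⟧ᵉ xs = lookup xs i
  ⟦ lit n ⟧ᵉ xs = n
  ⟦ call f es ⟧ᵉ xs = proj₁ f (⟦ es ⟧ᵉˢ xs)

  ⟦_⟧ᵉˢ : ∀ {k m} → Vec (Expr k) m → Vec ℕ k → Vec ℕ m
  ⟦ [] ⟧ᵉˢ xs = []
  ⟦ e ∷ es ⟧ᵉˢ xs = ⟦ e ⟧ᵉ xs ∷ ⟦ es ⟧ᵉˢ xs

uncurry₁ : (ℕ → ℕ) → Vec ℕ 1 → ℕ
uncurry₁ f (x ∷ []) = f x
uncurry₂ : (ℕ → ℕ → ℕ) → Vec ℕ 2 → ℕ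
uncurry₂ f (x ∷ y ∷ []) = f x y
uncurry₃ : (ℕ → ℕ → ℕ → ℕ) → Vec ℕ 3 → ℕ
uncurry₃ f (x ∷ y ∷ z ∷ []) = f x y z
uncurry₄ : (ℕ → ℕ → ℕ → ℕ → ℕ) → Vec ℕ 4 → ℕ
uncurry₄ f (x ∷ y ∷ z ∷ w ∷ []) = f x y z w

PR₁ : (ℕ → ℕ) → Set
PR₁ f = IsPR (uncurry₁ f)
PR₂ : (ℕ → ℕ → ℕ) → Set
PR₂ f = IsPR (uncurry₂ f)
PR₃ : (ℕ → ℕ → ℕ → ℕ) → Set
PR₃ f = IsPR (uncurry₃ f)
PR₄ : (ℕ → ℕ → ℕ → ℕ → ℕ) → Set
PR₄ f = IsPR (uncurry₄ f)

suc-pr : PR₁ suc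
suc-pr = mkPR succF (λ { (x ∷ []) → ev-succ })

constant : ∀ {k} → ℕ → Vec ℕ k → ℕ
constant n _ = n

const-pr : ∀ {k} n → IsPR {k} (constant n)
const-pr zero = zero-pr
const-pr (suc n) = comp-pr suc-pr (const-pr n ∷ [])

mutual
  expr-pr : ∀ {k} (e : Expr k) → IsPR ⟦ e ⟧ᵉ
  expr-pr (arg i) = proj-pr i
  expr-pr (lit n) = const-pr n
  expr-pr (call f es) = isPR-resp (λ xs → cong (proj₁ f) (applyEach-exprFns es xs)) (comp-pr (proj₂ f) (exprs-pr es))

  exprFns : ∀ {k m} → Vec (Expr k) m → Vec (Vec ℕ k → ℕ) m
  exprFns [] = []
  exprFns (e ∷ es) = ⟦ e ⟧ᵉ ∷ exprFns es

  exprs-pr : ∀ {k m} (es : Vec (Expr k) m) → AllPR (exprFns es)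
  exprs-pr [] = []
  exprs-pr (e ∷ es) = expr-pr e ∷ exprs-pr es

  applyEach-exprFns : ∀ {k m} (es : Vec (Expr k) m) xs → applyEach (exprFns es) xs ≡ ⟦ es ⟧ᵉˢ xs
  applyEach-exprFns [] xs = refl
  applyEach-exprFns (e ∷ es) xs = cong (⟦ e ⟧ᵉ xs ∷_) (applyEach-exprFns es xs)

call₁ : ∀ {k} {f : ℕ → ℕ} → PR₁ f → Expr k → Expr k
call₁ {f = f} p a = call (uncurry₁ f , p) (a ∷ [])
call₂ : ∀ {k} {f : ℕ → ℕ → ℕ} → PR₂ f → Expr k → Expr k → Expr k
call₂ {f = f} p a b = call (uncurry₂ f , p) (a ∷ b ∷ [])
call₃ : ∀ {k} {f : ℕ → ℕ → ℕ → ℕ} → PR₃ f → Expr k → Expr k → Expr k → Expr k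
call₃ {f = f} p a b c = call (uncurry₃ f , p) (a ∷ b ∷ c ∷ [])
call₄ : ∀ {k} {f : ℕ → ℕ → ℕ → ℕ → ℕ} → PR₄ f → Expr k → Expr k → Expr k → Expr k → Expr k
call₄ {f = f} p a b c d = call (uncurry₄ f , p) (a ∷ b ∷ c ∷ d ∷ [])

arg₀ : ∀ {k} → Expr (suc k)
arg₀ = arg zero
arg₁ : ∀ {k} → Expr (suc (suc k))
arg₁ = arg (suc zero)
arg₂ : ∀ {k} → Expr (suc (suc (suc k)))
arg₂ = arg (suc (suc zero))
arg₃ : ∀ {k} → Expr (suc (suc (suc (suc k))))
arg₃ = arg (suc (suc (suc zero)))

byExpr₁ : {f : ℕ → ℕ} (e : Expr 1) → (∀ x → ⟦ e ⟧ᵉ (x ∷ []) ≡ f x) → PR₁ f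
byExpr₁ e h = isPR-resp (λ { (x ∷ []) → h x }) (expr-pr e)
byExpr₂ : {f : ℕ → ℕ → ℕ} (e : Expr 2) → (∀ x y → ⟦ e ⟧ᵉ (x ∷ y ∷ []) ≡ f x y) → PR₂ f
byExpr₂ e h = isPR-resp (λ { (x ∷ y ∷ []) → h x y }) (expr-pr e)
byExpr₃ : {f : ℕ → ℕ → ℕ → ℕ} (e : Expr 3) → (∀ x y z → ⟦ e ⟧ᵉ (x ∷ y ∷ z ∷ []) ≡ f x y z) → PR₃ f
byExpr₃ e h = isPR-resp (λ { (x ∷ y ∷ z ∷ []) → h x y z }) (expr-pr e)
byExpr₄ : {f : ℕ → ℕ → ℕ → ℕ → ℕ} (e : Expr 4) → (∀ x y z w → ⟦ e ⟧ᵉ (x ∷ y ∷ z ∷ w ∷ []) ≡ f x y z w) → PR₄ f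
byExpr₄ e h = isPR-resp (λ { (x ∷ y ∷ z ∷ w ∷ []) → h x y z w }) (expr-pr e)

PR₁-natrec : {f : ℕ → ℕ} (a : ℕ) {h : ℕ → ℕ → ℕ} → PR₂ h → f 0 ≡ a → (∀ n → f (suc n) ≡ h n (f n)) → PR₁ f
PR₁-natrec {f} a {h} ph e0 eS = isPR-resp go (rec-pr (const-pr {0} a) (isPR-resp (λ { (x ∷ y ∷ []) → refl }) ph))
  where
  go : ∀ xs → natrec (constant a) (uncurry₂ h) xs ≡ uncurry₁ f xs
  go (zero ∷ []) = sym e0
  go (suc n ∷ []) = trans (cong (h n) (go (n ∷ []))) (sym (eS n))

PR₂-natrec : {f : ℕ → ℕ → ℕ} {g : ℕ → ℕ} {h : ℕ → ℕ → ℕ → ℕ} → PR₁ g → PR₃ h →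
       (∀ y → f 0 y ≡ g y) → (∀ n y → f (suc n) y ≡ h n (f n y) y) → PR₂ f
PR₂-natrec {f} {g} {h} pg ph e0 eS = isPR-resp go (rec-pr pg ph)
  where
  go : ∀ xs → natrec (uncurry₁ g) (uncurry₃ h) xs ≡ uncurry₂ f xs
  go (zero ∷ y ∷ []) = sym (e0 y)
  go (suc n ∷ y ∷ []) = trans (cong (λ r → h n r y) (go (n ∷ y ∷ []))) (sym (eS n y))

ifz : ℕ → ℕ → ℕ → ℕ
ifz zero a b = a
ifz (suc _) a b = b

ifz-pr : PR₃ ifz
ifz-pr = isPR-resp (λ { (zero ∷ a ∷ b ∷ []) → refl ; (suc n ∷ a ∷ b ∷ []) → refl })
  (rec-pr (proj-pr zero) (proj-pr (suc (suc (suc zero)))))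

isZero : ℕ → ℕ
isZero x = ifz x 1 0

isZero-pr : PR₁ isZero
isZero-pr = byExpr₁ (call₃ ifz-pr arg₀ (lit 1) (lit 0)) (λ _ → refl)

+-pr : PR₂ _+_
+-pr = PR₂-natrec {g = λ y → y} {h = λ n r y → suc r} (byExpr₁ arg₀ (λ _ → refl)) (byExpr₃ (call₁ suc-pr arg₁) (λ _ _ _ → refl))
  (λ y → refl) (λ n y → refl)

pred-pr : PR₁ pred
pred-pr = PR₁-natrec 0 {h = λ n r → n} (byExpr₂ arg₀ (λ _ _ → refl)) refl (λ n → refl)

∸-pr : PR₂ _∸_
∸-pr = byExpr₂ (call₂ flip∸-pr arg₁ arg₀) (λ x y → refl)
  where
  flip∸-pr : PR₂ (λ y x → x ∸ y)
  flip∸-pr = PR₂-natrec {g = λ x → x} {h = λ n r x → pred r} (byExpr₁ arg₀ (λ _ → refl)) (byExpr₃ (call₁ pred-pr arg₁) (λ _ _ _ → refl))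
    (λ x → refl) (λ n x → sym (pred[m∸n]≡m∸[1+n] x n))

tri-pr : PR₁ tri
tri-pr = PR₁-natrec 0 {h = λ n r → suc n + r} (byExpr₂ (call₂ +-pr (call₁ suc-pr arg₀) arg₁) (λ _ _ → refl)) refl (λ n → refl)

cantor-pr : PR₂ cantor
cantor-pr = byExpr₂ (call₂ +-pr (call₁ tri-pr (call₂ +-pr arg₀ arg₁)) arg₁) (λ _ _ → refl)

∸-isSuc : ∀ b j → j < b → IsSuc (b ∸ j)
∸-isSuc (suc b) zero lt = b , refl
∸-isSuc (suc b) (suc j) (s≤s lt) = ∸-isSuc b j lt

m∸n≡suc[m∸suc[n]] : ∀ m n → n < m → m ∸ n ≡ suc (m ∸ suc n)
m∸n≡suc[m∸suc[n]] (suc m) zero lt = refl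
m∸n≡suc[m∸suc[n]] (suc m) (suc n) (s≤s lt) = m∸n≡suc[m∸suc[n]] m n lt

-- firstZero f n is the least j < n with f j ≡ 0, and n if there is none.

opaque
  firstZero : (ℕ → ℕ) → ℕ → ℕ
  firstZero f zero = zero
  firstZero f (suc n) = ifz (f 0) 0 (suc (firstZero (λ j → f (suc j)) n))

  firstZero-≤ : ∀ f n → firstZero f n ≤ n
  firstZero-≤ f zero = z≤n
  firstZero-≤ f (suc n) with f 0
  ... | zero = z≤n
  ... | suc _ = s≤s (firstZero-≤ (λ j → f (suc j)) n)

  firstZero-zero : ∀ f n → firstZero f n < n → f (firstZero f n) ≡ 0
  firstZero-zero f (suc n) lt with f 0 in eq
  ... | zero = eq
  ... | suc _ = firstZero-zero (λ j → f (suc j)) n (≤-pred lt)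

  firstZero-minimal : ∀ f n j → j < firstZero f n → IsSuc (f j)
  firstZero-minimal f (suc n) j lt with f 0 in eq
  firstZero-minimal f (suc n) zero lt | suc r = r , eq
  firstZero-minimal f (suc n) (suc j) lt | suc r = firstZero-minimal (λ j → f (suc j)) n j (≤-pred lt)

  firstZero-≤-zero : ∀ f n j → f j ≡ 0 → firstZero f n ≤ j
  firstZero-≤-zero f zero j e = z≤n
  firstZero-≤-zero f (suc n) j e with f 0 in eq
  ... | zero = z≤n
  firstZero-≤-zero f (suc n) zero e | suc r = ⊥-elim (1+n≢0 (trans (sym eq) e))
  firstZero-≤-zero f (suc n) (suc j) e | suc r = s≤s (firstZero-≤-zero (λ j → f (suc j)) n j e)

  firstZero-lower : ∀ f n j → (∀ i → i < j → IsSuc (f i)) → j ≤ n → j ≤ firstZero f n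
  firstZero-lower f n zero h le = z≤n
  firstZero-lower f (suc n) (suc j) h (s≤s le) with f 0 in eq
  ... | zero = ⊥-elim (0≢1+n (trans (sym eq) (proj₂ (h 0 (s≤s z≤n)))))
  ... | suc _ = s≤s (firstZero-lower (λ j → f (suc j)) n j (λ i i< → h (suc i) (s≤s i<)) le)

  firstZero-exact : ∀ f n j → j ≤ n → (j < n → f j ≡ 0) → (∀ i → i < j → IsSuc (f i)) → firstZero f n ≡ j
  firstZero-exact f n j le hz hl with m≤n⇒m<n∨m≡n le
  ... | inj₁ lt = ≤-antisym (firstZero-≤-zero f n j (hz lt)) (firstZero-lower f n j hl le)
  ... | inj₂ refl = ≤-antisym (firstZero-≤ f n) (firstZero-lower f n n hl ≤-refl)

-- firstZero is computed by μ-search on the guarded f j, made 0 once j reaches the bound.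
firstZero-pr : ∀ {k} {f : Vec ℕ (suc k) → ℕ} {b : Vec ℕ k → ℕ} → IsPR f → IsPR b →
             IsPR (λ xs → firstZero (λ j → f (j ∷ xs)) (b xs))
firstZero-pr {k} {f} {b} pf pb = mu-pr {f = guarded} guarded-pr hit below
  where
  guarded : Vec ℕ (suc k) → ℕ
  guarded (j ∷ xs) = ifz (b xs ∸ j) 0 (f (j ∷ xs))
  room : Vec ℕ (suc k) → ℕ
  room v = b (tail v) ∸ lookup v zero
  room-pr : IsPR room
  room-pr = comp-pr {f = uncurry₂ _∸_} {gs = (λ v → b (tail v)) ∷ (λ v → lookup v zero) ∷ []} ∸-pr (tail-pr pb ∷ proj-pr zero ∷ [])
  guarded-pr : IsPR guarded
  guarded-pr = isPR-resp (λ { (j ∷ xs) → refl })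
    (comp-pr {f = uncurry₃ ifz} {gs = room ∷ constant 0 ∷ f ∷ []} ifz-pr (room-pr ∷ const-pr 0 ∷ pf ∷ []))
  hit : ∀ xs → guarded (firstZero (λ j → f (j ∷ xs)) (b xs) ∷ xs) ≡ 0
  hit xs with firstZero (λ j → f (j ∷ xs)) (b xs) <? b xs
  ... | yes lt = trans (cong (λ t → ifz t 0 (f (firstZero (λ j → f (j ∷ xs)) (b xs) ∷ xs))) (proj₂ (∸-isSuc _ _ lt)))
                       (firstZero-zero (λ j → f (j ∷ xs)) (b xs) lt)
  ... | no nlt = cong (λ t → ifz t 0 (f (firstZero (λ j → f (j ∷ xs)) (b xs) ∷ xs)))
                       (m≤n⇒m∸n≡0 (≮⇒≥ nlt))
  below : ∀ xs j → j < firstZero (λ j → f (j ∷ xs)) (b xs) → IsSuc (guarded (j ∷ xs))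
  below xs j lt = subst (λ t → IsSuc (ifz t 0 (f (j ∷ xs)))) (sym (proj₂ (∸-isSuc _ _ (<-≤-trans lt (firstZero-≤ _ (b xs))))))
                    (firstZero-minimal (λ j → f (j ∷ xs)) (b xs) j lt)

tri-mono : ∀ {i j} → i ≤ j → tri i ≤ tri j
tri-mono {zero} {j} le = z≤n
tri-mono {suc i} {suc j} (s≤s le) = +-mono-≤ (s≤s le) (tri-mono le)

n≤tri : ∀ n → n ≤ tri n
n≤tri zero = z≤n
n≤tri (suc n) = m≤m+n (suc n) (tri n)

root : ℕ → ℕ
root p = firstZero (λ s → suc p ∸ tri (suc s)) (suc p)

root-pr : PR₁ root
root-pr = isPR-resp (λ { (p ∷ []) → refl })
  (firstZero-pr {f = uncurry₂ (λ s p → suc p ∸ tri (suc s))} {b = uncurry₁ suc}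
     (byExpr₂ (call₂ ∸-pr (call₁ suc-pr arg₁) (call₁ tri-pr (call₁ suc-pr arg₀))) (λ _ _ → refl)) suc-pr)

root-cantor : ∀ x y → root (cantor x y) ≡ x + y
root-cantor x y = firstZero-exact _ _ (x + y) le hz hl
  where
  s = x + y
  p = tri s + y
  le : s ≤ suc p
  le = ≤-trans (n≤tri s) (≤-trans (m≤m+n (tri s) y) (n≤1+n p))
  hz : s < suc p → suc p ∸ tri (suc s) ≡ 0
  hz _ = m≤n⇒m∸n≡0 (s≤s (subst (λ t → t ≤ s + tri s) (+-comm y (tri s)) (+-monoˡ-≤ (tri s) (m≤n+m y x))))
  hl : ∀ i → i < s → IsSuc (suc p ∸ tri (suc i))
  hl i lt = ∸-isSuc (suc p) (tri (suc i)) (s≤s (≤-trans (tri-mono lt) (m≤m+n (tri s) y)))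

π₂ : ℕ → ℕ
π₂ p = p ∸ tri (root p)
π₁ : ℕ → ℕ
π₁ p = root p ∸ π₂ p

π₂-pr : PR₁ π₂
π₂-pr = byExpr₁ (call₂ ∸-pr arg₀ (call₁ tri-pr (call₁ root-pr arg₀))) (λ _ → refl)
π₁-pr : PR₁ π₁
π₁-pr = byExpr₁ (call₂ ∸-pr (call₁ root-pr arg₀) (call₁ π₂-pr arg₀)) (λ _ → refl)

π₂-cantor : ∀ x y → π₂ (cantor x y) ≡ y
π₂-cantor x y rewrite root-cantor x y = m+n∸m≡n (tri (x + y)) y

π₁-cantor : ∀ x y → π₁ (cantor x y) ≡ x
π₁-cantor x y rewrite π₂-cantor x y | root-cantor x y = m+n∸n≡m x y

opaque
  hd : ℕ → ℕ
  hd m = π₁ (pred m)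
  tl : ℕ → ℕ
  tl m = π₂ (pred m)

  hd-pr : PR₁ hd
  hd-pr = byExpr₁ (call₁ π₁-pr (call₁ pred-pr arg₀)) (λ _ → refl)
  tl-pr : PR₁ tl
  tl-pr = byExpr₁ (call₁ π₂-pr (call₁ pred-pr arg₀)) (λ _ → refl)

  hd-code : ∀ x l → hd (code (x ∷ l)) ≡ x
  hd-code x l = π₁-cantor x (code l)
  tl-code : ∀ x l → tl (code (x ∷ l)) ≡ code l
  tl-code x l = π₂-cantor x (code l)

  tl-0 : tl 0 ≡ 0
  tl-0 = 0∸n≡0 (tri (root 0))

drop : ℕ → ℕ → ℕ
drop zero m = m
drop (suc i) m = drop i (tl m)

drop-suc : ∀ i m → drop (suc i) m ≡ tl (drop i m)
drop-suc zero m = refl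
drop-suc (suc i) m = drop-suc i (tl m)

drop-pr : PR₂ drop
drop-pr = PR₂-natrec {g = λ m → m} {h = λ i r m → tl r} (byExpr₁ arg₀ (λ _ → refl)) (byExpr₃ (call₁ tl-pr arg₁) (λ _ _ _ → refl))
  (λ _ → refl) drop-suc

prefix-ext : ∀ (f g : Baire) n → (∀ t → t < n → f t ≡ g t) → prefix f n ≡ prefix g n
prefix-ext f g zero h = refl
prefix-ext f g (suc n) h = cong₂ _∷_ (h 0 (s≤s z≤n)) (prefix-ext (λ t → f (suc t)) (λ t → g (suc t)) n (λ t lt → h (suc t) (s≤s lt)))

drop-0 : ∀ i → drop i 0 ≡ 0
drop-0 zero = refl
drop-0 (suc i) = trans (cong (drop i) tl-0) (drop-0 i)

drop-prefix : ∀ i (β : Baire) n → drop i (code (prefix β n)) ≡ code (prefix (λ t → β (i + t)) (n ∸ i))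
drop-prefix zero β n = refl
drop-prefix (suc i) β zero = drop-0 (suc i)
drop-prefix (suc i) β (suc n) = trans (cong (drop i) (tl-code (β 0) (prefix (λ t → β (suc t)) n)))
                                     (drop-prefix i (λ t → β (suc t)) n)

opaque
  nth : ℕ → ℕ → ℕ
  nth A i = hd (drop i A)

  nth-pr : PR₂ nth
  nth-pr = byExpr₂ (call₁ hd-pr (call₂ drop-pr arg₁ arg₀)) (λ _ _ → refl)

  nth-prefix : ∀ (β : Baire) n i → i < n → nth (code (prefix β n)) i ≡ β i
  nth-prefix β n i lt rewrite drop-prefix i β n | m∸n≡suc[m∸suc[n]] n i lt =
    trans (hd-code (β (i + 0)) _) (cong β (+-identityʳ i))

cantor-≥ : ∀ x y → y ≤ cantor x y
cantor-≥ x y = m≤n+m y (tri (x + y))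

length≤code : ∀ (β : Baire) n → n ≤ code (prefix β n)
length≤code β zero = z≤n
length≤code β (suc n) = s≤s (≤-trans (length≤code (λ t → β (suc t)) n) (cantor-≥ (β 0) _))

opaque
  len : ℕ → ℕ
  len A = firstZero (λ i → drop i A) A

  len-pr : PR₁ len
  len-pr = isPR-resp (λ { (a ∷ []) → refl }) (firstZero-pr {f = uncurry₂ drop} {b = uncurry₁ (λ a → a)} drop-pr (byExpr₁ arg₀ (λ _ → refl)))

  len-prefix : ∀ (β : Baire) n → len (code (prefix β n)) ≡ n
  len-prefix β n = firstZero-exact _ _ n (length≤code β n) hz hl
    where
    hz : n < code (prefix β n) → drop n (code (prefix β n)) ≡ 0
    hz _ rewrite drop-prefix n β n | n∸n≡0 n = refl
    hl : ∀ i → i < n → IsSuc (drop i (code (prefix β n)))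
    hl i lt rewrite drop-prefix i β n | m∸n≡suc[m∸suc[n]] n i lt = _ , refl

prefixCodeᵛ : ∀ {k} (β : Vec ℕ (suc k) → ℕ) → Vec ℕ (suc k) → ℕ
prefixCodeᵛ β (n ∷ ps) = code (prefix (λ t → β (t ∷ ps)) n)

tabulate-↑ʳ : ∀ {k m} (xs : Vec ℕ m) (ps : Vec ℕ k) →
  tabulate (λ j → lookup (xs ++ ps) (m ↑ʳ j)) ≡ ps
tabulate-↑ʳ [] ps = tabulate∘lookup ps
tabulate-↑ʳ (x ∷ xs) ps = tabulate-↑ʳ xs ps

-- natrec builds the code from the back: after i steps it holds the code of the
-- values at n ∸ i, …, n ∸ 1.
prefixCode-pr : ∀ {k} {β : Vec ℕ (suc k) → ℕ} → IsPR β → IsPR (prefixCodeᵛ β)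
prefixCode-pr {k} {β} pβ = isPR-resp result (comp-pr (rec-pr {g = constant 0} {h = step} (const-pr 0) step-pr) startArgs-pr)
  where
  shiftedArgs : Vec ℕ (suc (suc (suc k))) → Vec ℕ (suc k)
  shiftedArgs (i ∷ r ∷ n ∷ ps) = (n ∸ suc i) ∷ ps
  step : Vec ℕ (suc (suc (suc k))) → ℕ
  step (i ∷ r ∷ n ∷ ps) = suc (cantor (β ((n ∸ suc i) ∷ ps)) r)
  shiftedArgFns : Vec (Vec ℕ (suc (suc (suc k))) → ℕ) (suc k)
  shiftedArgFns = (λ v → lookup v (suc (suc zero)) ∸ suc (lookup v zero)) ∷ tabulate (λ j v → lookup v (suc (suc (suc j))))
  shiftedArgFns-pr : AllPR shiftedArgFns
  shiftedArgFns-pr = isPR-resp (λ { (i ∷ r ∷ n ∷ ps) → refl }) (expr-pr {3 + k} (call₂ ∸-pr arg₂ (call₁ suc-pr arg₀)))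
                     ∷ tabulate-pr _ (λ j → proj-pr (suc (suc (suc j))))
  shiftedArgFns-correct : ∀ v → applyEach shiftedArgFns v ≡ shiftedArgs v
  shiftedArgFns-correct (i ∷ r ∷ n ∷ ps) =
    cong ((n ∸ suc i) ∷_) (trans (applyEach-tabulate _ (i ∷ r ∷ n ∷ ps)) (tabulate-↑ʳ (i ∷ r ∷ n ∷ []) ps))
  shifted-pr : IsPR (λ v → β (shiftedArgs v))
  shifted-pr = isPR-resp (λ v → cong β (shiftedArgFns-correct v)) (comp-pr pβ shiftedArgFns-pr)
  step-pr : IsPR step
  step-pr = isPR-resp (λ { (i ∷ r ∷ n ∷ ps) → refl })
    (comp-pr {f = uncurry₁ suc} {gs = (λ v → cantor (β (shiftedArgs v)) (lookup v (suc zero))) ∷ []} suc-pr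
      (comp-pr {f = uncurry₂ cantor} {gs = (λ v → β (shiftedArgs v)) ∷ (λ v → lookup v (suc zero)) ∷ []} cantor-pr
         (shifted-pr ∷ proj-pr (suc zero) ∷ []) ∷ []))
  startArgs : Vec (Vec ℕ (suc k) → ℕ) (suc (suc k))
  startArgs = (λ v → lookup v zero) ∷ (λ v → lookup v zero) ∷ tabulate (λ j v → lookup v (suc j))
  startArgs-pr : AllPR startArgs
  startArgs-pr = proj-pr zero ∷ proj-pr zero ∷ tabulate-pr _ (λ j → proj-pr (suc j))
  natrec-step : ∀ i n ps → i ≤ n → natrec (constant 0) step (i ∷ n ∷ ps) ≡ code (prefix (λ t → β ((n ∸ i + t) ∷ ps)) i)
  natrec-step zero n ps le = refl
  natrec-step (suc i) n ps le = cong suc (cong₂ cantor (cong (λ t → β (t ∷ ps)) (sym (+-identityʳ (n ∸ suc i))))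
      (trans (natrec-step i n ps (≤-trans (n≤1+n i) le))
         (cong code (prefix-ext _ _ i (λ t _ → cong (λ s → β (s ∷ ps)) (shift t))))))
    where
    shift : ∀ t → n ∸ i + t ≡ n ∸ suc i + suc t
    shift t = trans (cong (_+ t) (m∸n≡suc[m∸suc[n]] n i le)) (sym (+-suc (n ∸ suc i) t))
  result : ∀ v → natrec (constant 0) step (applyEach startArgs v) ≡ prefixCodeᵛ β v
  result (n ∷ ps) =
    trans (cong (natrec (constant 0) step) (cong (λ z → n ∷ n ∷ z) (trans (applyEach-tabulate _ (n ∷ ps)) (tabulate∘lookup ps))))
      (trans (natrec-step n n ps ≤-refl) (cong code (prefix-ext _ _ n (λ t _ → cong (λ s → β (s ∷ ps)) (cong (_+ t) (n∸n≡0 n))))))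

Out-det : ∀ {γ β m m'} → Out γ β m → Out γ β m' → m ≡ m'
Out-det {γ} {β} (k , e , z) (k' , e' , z') with <-cmp k k'
... | tri< lt _ _ = ⊥-elim (0≢1+n (trans (sym (z' k lt)) e))
... | tri≈ _ refl _ = suc-injective (trans (sym e) e')
... | tri> _ _ gt = ⊥-elim (0≢1+n (trans (sym (z k' gt)) e'))

Out-intro : ∀ γ β m → (∀ k → γ (prefix β k) ≡ 0 ⊎ γ (prefix β k) ≡ suc m) → (k0 : ℕ) → IsSuc (γ (prefix β k0)) → Out γ β m
Out-intro γ β m dich k0 (r , e0) = K , eK , zK
  where
  f : ℕ → ℕ
  f k = isZero (γ (prefix β k))
  K = firstZero f (suc k0)
  fk0 : f k0 ≡ 0
  fk0 rewrite e0 = refl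
  Klt : K < suc k0
  Klt = s≤s (firstZero-≤-zero f (suc k0) k0 fk0)
  eK : γ (prefix β K) ≡ suc m
  eK with dich K
  ... | inj₂ e = e
  ... | inj₁ e = ⊥-elim (0≢1+n (trans (sym (firstZero-zero f (suc k0) Klt)) (cong isZero e)))
  zK : ∀ j → j < K → γ (prefix β j) ≡ 0
  zK j lt with γ (prefix β j) in eq | firstZero-minimal f (suc k0) j lt
  ... | zero | _ = refl

cantor-monoʳ-< : ∀ x {y y'} → y < y' → cantor x y < cantor x y'
cantor-monoʳ-< x {y} {y'} lt = +-mono-≤-< (tri-mono (+-monoʳ-≤ x (<⇒≤ lt))) lt

prefixCode-mono : ∀ (β : Baire) {j k} → j < k → code (prefix β j) < code (prefix β k)
prefixCode-mono β {zero} {suc k} lt = s≤s z≤n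
prefixCode-mono β {suc j} {suc k} (s≤s lt) = s≤s (cantor-monoʳ-< (β 0) (prefixCode-mono (λ t → β (suc t)) lt))

queryCode-mono : ∀ n (β : Baire) {j k} → j < k → code (n ∷ prefix β j) < code (n ∷ prefix β k)
queryCode-mono n β lt = s≤s (cantor-monoʳ-< n (prefixCode-mono β lt))

-- Given codes A and S of prefixes of α and β, approxApp A S n is suc ((α · β) n)
-- if the prefixes already determine that value, and 0 otherwise.
opaque
  queryCode : ℕ → ℕ → ℕ → ℕ
  queryCode S n k = suc (cantor n (code (prefix (nth S) k)))

  approxAt : ℕ → ℕ → ℕ → ℕ → ℕ
  approxAt A S n k = ifz (suc (len S) ∸ k) 0 (ifz (len A ∸ queryCode S n k) 0 (nth A (queryCode S n k)))

  approxApp : ℕ → ℕ → ℕ → ℕ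
  approxApp A S n = approxAt A S n (firstZero (λ k → isZero (approxAt A S n k)) (suc (len S)))

  queryCode-prefix : ∀ (β : Baire) NS n j → j ≤ NS → queryCode (code (prefix β NS)) n j ≡ code (n ∷ prefix β j)
  queryCode-prefix β NS n j le = cong (λ l → suc (cantor n (code l)))
    (prefix-ext _ _ j (λ t lt → nth-prefix β NS t (<-≤-trans lt le)))

  approxAt-inside : ∀ A S n j → j < suc (len S) → queryCode S n j < len A → approxAt A S n j ≡ nth A (queryCode S n j)
  approxAt-inside A S n j l1 l2 = trans (cong (λ t → ifz t 0 (ifz (len A ∸ queryCode S n j) 0 (nth A (queryCode S n j)))) (proj₂ (∸-isSuc _ _ l1)))
                               (cong (λ t → ifz t 0 (nth A (queryCode S n j))) (proj₂ (∸-isSuc _ _ l2)))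

  approxAt-beyondInput : ∀ A S n j → suc (len S) ≤ j → approxAt A S n j ≡ 0
  approxAt-beyondInput A S n j le = cong (λ t → ifz t 0 (ifz (len A ∸ queryCode S n j) 0 (nth A (queryCode S n j)))) (m≤n⇒m∸n≡0 le)

  approxAt-beyondCode : ∀ A S n j → j < suc (len S) → len A ≤ queryCode S n j → approxAt A S n j ≡ 0
  approxAt-beyondCode A S n j l1 l2 = trans (cong (λ t → ifz t 0 (ifz (len A ∸ queryCode S n j) 0 (nth A (queryCode S n j)))) (proj₂ (∸-isSuc _ _ l1)))
                               (cong (λ t → ifz t 0 (nth A (queryCode S n j))) (m≤n⇒m∸n≡0 l2))

  approxAt-prefix : ∀ (α β : Baire) NA NS n j → j ≤ NS → code (n ∷ prefix β j) < NA →
    approxAt (code (prefix α NA)) (code (prefix β NS)) n j ≡ α (code (n ∷ prefix β j))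
  approxAt-prefix α β NA NS n j le lt =
    trans (approxAt-inside (code (prefix α NA)) (code (prefix β NS)) n j (subst (λ t → j < suc t) (sym (len-prefix β NS)) (s≤s le))
                          (subst₂ _<_ (sym (queryCode-prefix β NS n j le)) (sym (len-prefix α NA)) lt))
          (trans (cong (nth (code (prefix α NA))) (queryCode-prefix β NS n j le)) (nth-prefix α NA _ lt))

  approxAt-suc : ∀ (α β : Baire) NA NS n j r → approxAt (code (prefix α NA)) (code (prefix β NS)) n j ≡ suc r →
    (j ≤ NS) × (code (n ∷ prefix β j) < NA)
  approxAt-suc α β NA NS n j r e with j ≤? NS
  ... | no nle = ⊥-elim (0≢1+n (trans (sym (approxAt-beyondInput (code (prefix α NA)) (code (prefix β NS)) n j (subst (λ t → suc t ≤ j) (sym (len-prefix β NS)) (≰⇒> nle)))) e))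
  ... | yes le with code (n ∷ prefix β j) <? NA
  ... | yes lt = le , lt
  ... | no nlt = ⊥-elim (0≢1+n (trans (sym (approxAt-beyondCode (code (prefix α NA)) (code (prefix β NS)) n j (subst (λ t → j < suc t) (sym (len-prefix β NS)) (s≤s le))
                   (subst₂ _≤_ (sym (len-prefix α NA)) (sym (queryCode-prefix β NS n j le)) (≮⇒≥ nlt)))) e))

  isZero-isSuc : ∀ x → IsSuc (isZero x) → x ≡ 0
  isZero-isSuc zero _ = refl
  isZero-isSuc (suc x) (_ , ())

  approxApp-sound : ∀ (α β : Baire) NA NS n r → approxApp (code (prefix α NA)) (code (prefix β NS)) n ≡ suc r →
    Out (λ s → α (code (n ∷ s))) β r
  approxApp-sound α β NA NS n r e = K , eK , zK
    where
    A S K : ℕ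
    A = code (prefix α NA)
    S = code (prefix β NS)
    f : ℕ → ℕ
    f k = isZero (approxAt A S n k)
    K = firstZero f (suc (len S))
    h : (K ≤ NS) × (code (n ∷ prefix β K) < NA)
    h = approxAt-suc α β NA NS n K r e
    eK : α (code (n ∷ prefix β K)) ≡ suc r
    eK = trans (sym (approxAt-prefix α β NA NS n K (proj₁ h) (proj₂ h))) e
    zK : ∀ j → j < K → α (code (n ∷ prefix β j)) ≡ 0
    zK j lt = trans (sym (approxAt-prefix α β NA NS n j (≤-trans (<⇒≤ lt) (proj₁ h)) (<-trans (queryCode-mono n β lt) (proj₂ h))))
                    (isZero-isSuc _ (firstZero-minimal f (suc (len S)) j lt))

  approxApp-complete : ∀ (α β : Baire) NA NS n r → (o : Out (λ s → α (code (n ∷ s))) β r) →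
    proj₁ o ≤ NS → code (n ∷ prefix β (proj₁ o)) < NA →
    approxApp (code (prefix α NA)) (code (prefix β NS)) n ≡ suc r
  approxApp-complete α β NA NS n r (k , e , z) le lt = trans (cong (approxAt A S n) Keq) (trans (approxAt-prefix α β NA NS n k le lt) e)
    where
    A S : ℕ
    A = code (prefix α NA)
    S = code (prefix β NS)
    f : ℕ → ℕ
    f k = isZero (approxAt A S n k)
    Keq : firstZero f (suc (len S)) ≡ k
    Keq = firstZero-exact f (suc (len S)) k (subst (λ t → k ≤ suc t) (sym (len-prefix β NS)) (≤-trans le (n≤1+n NS)))
      (λ _ → cong isZero (trans (approxAt-prefix α β NA NS n k le lt) e))
      (λ i i< → 0 , cong isZero (trans (approxAt-prefix α β NA NS n i (≤-trans (<⇒≤ i<) le) (<-trans (queryCode-mono n β i<) lt)) (z i i<)))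

  nthPrefixCode : ℕ → ℕ → ℕ
  nthPrefixCode k S = code (prefix (nth S) k)

  nthPrefixCode-pr : PR₂ nthPrefixCode
  nthPrefixCode-pr = isPR-resp (λ { (k ∷ S ∷ []) → refl }) (prefixCode-pr {β = uncurry₂ (λ t S → nth S t)} (byExpr₂ (call₂ nth-pr arg₁ arg₀) (λ _ _ → refl)))

  queryCode-pr : PR₃ queryCode
  queryCode-pr = byExpr₃ (call₁ suc-pr (call₂ cantor-pr arg₁ (call₂ nthPrefixCode-pr arg₂ arg₀))) (λ _ _ _ → refl)

  approxAt-pr : PR₄ approxAt
  approxAt-pr = byExpr₄ (call₃ ifz-pr (call₂ ∸-pr (call₁ suc-pr (call₁ len-pr arg₁)) arg₃) (lit 0)
                (call₃ ifz-pr (call₂ ∸-pr (call₁ len-pr arg₀) (call₃ queryCode-pr arg₁ arg₂ arg₃)) (lit 0) (call₂ nth-pr arg₀ (call₃ queryCode-pr arg₁ arg₂ arg₃))))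
              (λ _ _ _ _ → refl)

  approxApp-pr : PR₃ approxApp
  approxApp-pr = byExpr₃ (call₄ approxAt-pr arg₀ arg₁ arg₂ (call₃ answerIndex-pr arg₀ arg₁ arg₂)) (λ _ _ _ → refl)
    where
    answerIndex : ℕ → ℕ → ℕ → ℕ
    answerIndex A S n = firstZero (λ k → isZero (approxAt A S n k)) (suc (len S))
    answerIndex-pr : PR₃ answerIndex
    answerIndex-pr = isPR-resp (λ { (A ∷ S ∷ n ∷ []) → refl })
      (firstZero-pr {f = uncurry₄ (λ k A S n → isZero (approxAt A S n k))} {b = uncurry₃ (λ A S n → suc (len S))}
        (byExpr₄ (call₁ isZero-pr (call₄ approxAt-pr arg₁ arg₂ arg₃ arg₀)) (λ _ _ _ _ → refl))
        (byExpr₃ (call₁ suc-pr (call₁ len-pr arg₁)) (λ _ _ _ → refl)))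

-- App is wrapped in a record so that its three arguments can be inferred.
record Ap (α β y : Baire) : Set where
  constructor mkAp
  field unAp : App α β y
open Ap public

-- knownPrefix X Z L codes the longest initial segment, of length at most L, of
-- x · z that is determined by the prefixes of x and z coded by X and Z.
opaque
  knownLength : ℕ → ℕ → ℕ → ℕ
  knownLength X Z L = firstZero (λ i → approxApp X Z i) L
  knownValue : ℕ → ℕ → ℕ → ℕ
  knownValue X Z i = pred (approxApp X Z i)
  knownPrefix : ℕ → ℕ → ℕ → ℕ
  knownPrefix X Z L = code (prefix (knownValue X Z) (knownLength X Z L))

  knownLength-pr : PR₃ knownLength
  knownLength-pr = isPR-resp (λ { (X ∷ Z ∷ L ∷ []) → refl })
    (firstZero-pr {f = uncurry₄ (λ i X Z L → approxApp X Z i)} {b = uncurry₃ (λ X Z L → L)} (byExpr₄ (call₃ approxApp-pr arg₁ arg₂ arg₀) (λ _ _ _ _ → refl))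
      (byExpr₃ arg₂ (λ _ _ _ → refl)))

  knownValuePrefix : ℕ → ℕ → ℕ → ℕ
  knownValuePrefix n X Z = code (prefix (knownValue X Z) n)

  knownValuePrefix-pr : PR₃ knownValuePrefix
  knownValuePrefix-pr = isPR-resp (λ { (n ∷ X ∷ Z ∷ []) → refl })
    (prefixCode-pr {β = uncurry₃ (λ t X Z → knownValue X Z t)} (byExpr₃ (call₁ pred-pr (call₃ approxApp-pr arg₁ arg₂ arg₀)) (λ _ _ _ → refl)))

  knownPrefix-pr : PR₃ knownPrefix
  knownPrefix-pr = byExpr₃ (call₃ knownValuePrefix-pr (call₃ knownLength-pr arg₀ arg₁ arg₂) arg₀ arg₁) (λ _ _ _ → refl)

  -- 𝐒₂ x y answers the query m = code (n ∷ s) by approximating x · s and y · s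
  -- from the first m values of x and y and applying the results at n.
  𝐒₂-approx : ℕ → ℕ → ℕ → ℕ
  𝐒₂-approx m X Y = approxApp (knownPrefix X (tl m) m) (knownPrefix Y (tl m) m) (hd m)

  𝐒₂-approx-pr : PR₃ 𝐒₂-approx
  𝐒₂-approx-pr = byExpr₃ (call₃ approxApp-pr (call₃ knownPrefix-pr arg₁ (call₁ tl-pr arg₀) arg₀) (call₃ knownPrefix-pr arg₂ (call₁ tl-pr arg₀) arg₀) (call₁ hd-pr arg₀)) (λ _ _ _ → refl)

  𝐒₂-approx-def : ∀ m X Y → 𝐒₂-approx m X Y ≡ approxApp (knownPrefix X (tl m) m) (knownPrefix Y (tl m) m) (hd m)
  𝐒₂-approx-def m X Y = refl

  knownPrefix-prefix : ∀ (x z a : Baire) NX ℓ L → App x z a →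
    knownPrefix (code (prefix x NX)) (code (prefix z ℓ)) L ≡ code (prefix a (knownLength (code (prefix x NX)) (code (prefix z ℓ)) L))
  knownPrefix-prefix x z a NX ℓ L hx = cong code (prefix-ext _ _ _ pt)
    where
    pt : ∀ i → i < knownLength (code (prefix x NX)) (code (prefix z ℓ)) L → knownValue (code (prefix x NX)) (code (prefix z ℓ)) i ≡ a i
    pt i lt with firstZero-minimal (λ i → approxApp (code (prefix x NX)) (code (prefix z ℓ)) i) L i lt
    ... | (r , e) = trans (cong pred e) (Out-det {γ = λ s → x (code (i ∷ s))} {β = z} (approxApp-sound x z NX ℓ i r e) (hx i))

  knownLength-lower : ∀ X Z L N → (∀ i → i < N → IsSuc (approxApp X Z i)) → N ≤ L → N ≤ knownLength X Z L
  knownLength-lower X Z L N h le = firstZero-lower _ L N h le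

-- On output position n, reading B G waits for B n digits of the input and then
-- answers G n applied to their code.
opaque
  reading : (ℕ → ℕ) → (ℕ → ℕ → ℕ) → Baire
  reading B G m = ifz (suc (len (tl m)) ∸ B (hd m)) 0 (suc (G (hd m) (tl m)))

  reading-pr : ∀ {B G} → PR₁ B → PR₂ G → PR₁ (reading B G)
  reading-pr pB pG = byExpr₁ (call₃ ifz-pr (call₂ ∸-pr (call₁ suc-pr (call₁ len-pr (call₁ tl-pr arg₀))) (call₁ pB (call₁ hd-pr arg₀))) (lit 0)
                        (call₁ suc-pr (call₂ pG (call₁ hd-pr arg₀) (call₁ tl-pr arg₀)))) (λ _ → refl)

  reading-app₀ : ∀ (B : ℕ → ℕ) (G : ℕ → ℕ → ℕ) (x F : Baire) → (∀ n → F n ≡ G n (code (prefix x (B n)))) → App (reading B G) x F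
  reading-app₀ B G x F h n = B n , eB , zB
    where
    val : ∀ k → reading B G (code (n ∷ prefix x k)) ≡ ifz (suc k ∸ B n) 0 (suc (G n (code (prefix x k))))
    val k = trans (cong (λ t → ifz (suc (len t) ∸ B (hd (code (n ∷ prefix x k)))) 0 (suc (G (hd (code (n ∷ prefix x k))) t))) (tl-code n (prefix x k)))
            (trans (cong (λ t → ifz (suc t ∸ B (hd (code (n ∷ prefix x k)))) 0 (suc (G (hd (code (n ∷ prefix x k))) (code (prefix x k))))) (len-prefix x k))
                   (cong (λ t → ifz (suc k ∸ B t) 0 (suc (G t (code (prefix x k))))) (hd-code n (prefix x k))))
    eB : reading B G (code (n ∷ prefix x (B n))) ≡ suc (F n)
    eB = trans (val (B n)) (trans (cong (λ t → ifz t 0 (suc (G n (code (prefix x (B n)))))) (proj₂ (∸-isSuc (suc (B n)) (B n) ≤-refl)))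
               (cong suc (sym (h n))))
    zB : ∀ j → j < B n → reading B G (code (n ∷ prefix x j)) ≡ 0
    zB j lt = trans (val j) (cong (λ t → ifz t 0 (suc (G n (code (prefix x j))))) (m≤n⇒m∸n≡0 lt))

  reading-def : ∀ B G m → reading B G m ≡ ifz (suc (len (tl m)) ∸ B (hd m)) 0 (suc (G (hd m) (tl m)))
  reading-def B G m = refl

reading-app : ∀ (B : ℕ → ℕ) (G : ℕ → ℕ → ℕ) (x F : Baire) → (∀ n → F n ≡ G n (code (prefix x (B n)))) → Ap (reading B G) x F
reading-app B G x F h = mkAp (reading-app₀ B G x F h)

Ap-≈-result : ∀ {α β y y'} → Ap α β y → y ≈ y' → Ap α β y'
Ap-≈-result (mkAp h) e = mkAp (λ n → proj₁ (h n) , trans (proj₁ (proj₂ (h n))) (cong suc (e n)) , proj₂ (proj₂ (h n)))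

prefix-≈ : ∀ {β β'} → β ≈ β' → ∀ k → prefix β k ≡ prefix β' k
prefix-≈ e k = prefix-ext _ _ k (λ t _ → e t)

Ap-≈-arg : ∀ {α β β' y} → Ap α β y → β ≈ β' → Ap α β' y
Ap-≈-arg {α} (mkAp h) e = mkAp (λ n → proj₁ (h n) , trans (cong (λ l → α (code (n ∷ l))) (sym (prefix-≈ e _))) (proj₁ (proj₂ (h n))) ,
  λ j lt → trans (cong (λ l → α (code (n ∷ l))) (sym (prefix-≈ e j))) (proj₂ (proj₂ (h n)) j lt))

Ap-≈-fun : ∀ {α α' β y} → Ap α β y → α ≈ α' → Ap α' β y
Ap-≈-fun {α} {α'} {β} (mkAp h) e = mkAp (λ n → proj₁ (h n) , trans (sym (e _)) (proj₁ (proj₂ (h n))) , λ j lt → trans (sym (e _)) (proj₂ (proj₂ (h n)) j lt))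

Ap-det : ∀ {α β y y'} → Ap α β y → Ap α β y' → y ≈ y'
Ap-det {α} {β} (mkAp h) (mkAp h') n = Out-det {γ = λ s → α (code (n ∷ s))} {β = β} (h n) (h' n)

Ap-cong : ∀ {α α' β β' y y'} → Ap α β y → Ap α' β' y' → α ≈ α' → β ≈ β' → y ≈ y'
Ap-cong h h' ea eb = Ap-det (Ap-≈-fun (Ap-≈-arg h eb) ea) h'

𝐊₁ : Baire → Baire
𝐊₁ x m = suc (x (hd m))

𝐊 : Baire
𝐊 = reading (λ n → suc (hd n)) (λ n X → suc (nth X (hd n)))

𝐊-pr : PR₁ 𝐊
𝐊-pr = reading-pr (byExpr₁ (call₁ suc-pr (call₁ hd-pr arg₀)) (λ _ → refl))
                  (byExpr₂ (call₁ suc-pr (call₂ nth-pr arg₁ (call₁ hd-pr arg₀))) (λ _ _ → refl))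

𝐊-app : ∀ x → Ap 𝐊 x (𝐊₁ x)
𝐊-app x = reading-app _ _ x (𝐊₁ x) (λ n → cong suc (sym (nth-prefix x (suc (hd n)) (hd n) ≤-refl)))

𝐊₁-app : ∀ x y → Ap (𝐊₁ x) y x
𝐊₁-app x y = mkAp (λ n → 0 , cong (λ t → suc (x t)) (hd-code n []) , (λ j ()))

𝐒₂ : Baire → Baire → Baire
𝐒₂ x y m = 𝐒₂-approx m (code (prefix x m)) (code (prefix y m))

𝐒₁ : Baire → Baire
𝐒₁ x = reading (λ m → m) (λ m Y → 𝐒₂-approx m (code (prefix x m)) Y)

𝐒 : Baire
𝐒 = reading hd (λ m' X → ifz (suc (len (tl m')) ∸ hd m') 0 (suc (𝐒₂-approx (hd m') X (tl m'))))

𝐒-pr : PR₁ 𝐒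
𝐒-pr = reading-pr hd-pr (byExpr₂ (call₃ ifz-pr (call₂ ∸-pr (call₁ suc-pr (call₁ len-pr (call₁ tl-pr arg₀))) (call₁ hd-pr arg₀)) (lit 0)
                      (call₁ suc-pr (call₃ 𝐒₂-approx-pr (call₁ hd-pr arg₀) arg₁ (call₁ tl-pr arg₀)))) (λ _ _ → refl))

𝐒-app : ∀ x → Ap 𝐒 x (𝐒₁ x)
𝐒-app x = reading-app _ _ x (𝐒₁ x) (λ m → reading-def _ _ m)

𝐒₁-app : ∀ x y → Ap (𝐒₁ x) y (𝐒₂ x y)
𝐒₁-app x y = reading-app _ _ y (𝐒₂ x y) (λ m → refl)

knownLengthAt : Baire → Baire → ℕ → ℕ → ℕ
knownLengthAt x z n l = knownLength (code (prefix x (code (n ∷ prefix z l)))) (code (prefix z l)) (code (n ∷ prefix z l))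

𝐒₂-query : ∀ {x y z a b} → Ap x z a → Ap y z b → ∀ n l →
  𝐒₂ x y (code (n ∷ prefix z l)) ≡ approxApp (code (prefix a (knownLengthAt x z n l))) (code (prefix b (knownLengthAt y z n l))) n
𝐒₂-query {x} {y} {z} {a} {b} (mkAp hx) (mkAp hy) n l = begin
  𝐒₂-approx m X Y                                                         ≡⟨ 𝐒₂-approx-def m X Y ⟩
  approxApp (knownPrefix X (tl m) m) (knownPrefix Y (tl m) m) (hd m)    ≡⟨ cong₂ (λ t h → approxApp (knownPrefix X t m) (knownPrefix Y t m) h)
                                                                                    (tl-code n (prefix z l)) (hd-code n (prefix z l)) ⟩
  approxApp (knownPrefix X Z m) (knownPrefix Y Z m) n                     ≡⟨ cong₂ (λ s t → approxApp s t n)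
                                                                                    (knownPrefix-prefix x z a m l m hx) (knownPrefix-prefix y z b m l m hy) ⟩
  approxApp (code (prefix a (knownLengthAt x z n l))) (code (prefix b (knownLengthAt y z n l))) n ∎
  where
  open ≡-Reasoning
  m = code (n ∷ prefix z l)
  X = code (prefix x m)
  Y = code (prefix y m)
  Z = code (prefix z l)

sumBelow : (ℕ → ℕ) → ℕ → ℕ
sumBelow f zero = 0
sumBelow f (suc N) = f N + sumBelow f N

≤-sumBelow : ∀ f N i → i < N → f i ≤ sumBelow f N
≤-sumBelow f (suc N) i (s≤s le) with m≤n⇒m<n∨m≡n le
... | inj₁ lt = ≤-trans (≤-sumBelow f N i lt) (m≤n+m _ (f N))
... | inj₂ refl = m≤m+n (f i) _

zero-or-suc : ∀ {c} v → (∀ r → v ≡ suc r → r ≡ c) → v ≡ 0 ⊎ v ≡ suc c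
zero-or-suc zero h = inj₁ refl
zero-or-suc (suc r) h = inj₂ (cong suc (h r refl))

𝐒₂-app : ∀ {x y z a b w} → Ap x z a → Ap y z b → Ap a b w → Ap (𝐒₂ x y) z w
𝐒₂-app {x} {y} {z} {a} {b} {w} (mkAp hx) (mkAp hy) (mkAp hab) = mkAp (λ n → 𝐒₂-out n)
  where
  𝐒₂-out : ∀ n → Out (λ s → 𝐒₂ x y (code (n ∷ s))) z (w n)
  𝐒₂-out n = Out-intro (λ s → 𝐒₂ x y (code (n ∷ s))) z (w n) zero-or-w ℓ (w n , defined)
   where
    query : ∀ l → 𝐒₂ x y (code (n ∷ prefix z l))
                  ≡ approxApp (code (prefix a (knownLengthAt x z n l))) (code (prefix b (knownLengthAt y z n l))) n
    query = 𝐒₂-query {x} {y} {z} {a} {b} (mkAp hx) (mkAp hy) n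
    zero-or-w : ∀ l → 𝐒₂ x y (code (n ∷ prefix z l)) ≡ 0 ⊎ 𝐒₂ x y (code (n ∷ prefix z l)) ≡ suc (w n)
    zero-or-w l = map (trans (query l)) (trans (query l))
      (zero-or-suc _ (λ r eq → Out-det {γ = λ s → a (code (n ∷ s))} {β = b}
                                  (approxApp-sound a b (knownLengthAt x z n l) (knownLengthAt y z n l) n r eq) (hab n)))
    -- w n is decided by a on the first q + 1 positions and by b on the first k;
    -- ℓ bounds the input digits and query codes that x and y need for those.
    k = proj₁ (hab n)
    q = code (n ∷ prefix b k)
    costˣ : ℕ → ℕ
    costˣ i = proj₁ (hx i) + code (i ∷ prefix z (proj₁ (hx i)))
    costʸ : ℕ → ℕ
    costʸ i = proj₁ (hy i) + code (i ∷ prefix z (proj₁ (hy i)))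
    ℓ = sumBelow costˣ (suc q) + sumBelow costʸ k + q + k
    costˣ≤ℓ : ∀ i → i < suc q → costˣ i ≤ ℓ
    costˣ≤ℓ i lt = ≤-trans (≤-sumBelow costˣ (suc q) i lt) (≤-trans (m≤m+n _ _) (≤-trans (m≤m+n _ _) (m≤m+n _ _)))
    costʸ≤ℓ : ∀ i → i < k → costʸ i ≤ ℓ
    costʸ≤ℓ i lt = ≤-trans (≤-sumBelow costʸ k i lt) (≤-trans (m≤n+m _ (sumBelow costˣ (suc q))) (≤-trans (m≤m+n _ _) (m≤m+n _ _)))
    q≤ℓ : q ≤ ℓ
    q≤ℓ = ≤-trans (m≤n+m q (sumBelow costˣ (suc q) + sumBelow costʸ k)) (m≤m+n _ k)
    k≤ℓ : k ≤ ℓ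
    k≤ℓ = m≤n+m k _
    m = code (n ∷ prefix z ℓ)
    ℓ<m : ℓ < m
    ℓ<m = s≤s (≤-trans (length≤code z ℓ) (cantor-≥ n _))
    x-known : ∀ i → i < suc q → approxApp (code (prefix x m)) (code (prefix z ℓ)) i ≡ suc (a i)
    x-known i lt = approxApp-complete x z m ℓ i (a i) (hx i) (≤-trans (m≤m+n _ _) (costˣ≤ℓ i lt))
                     (≤-<-trans (≤-trans (m≤n+m _ (proj₁ (hx i))) (costˣ≤ℓ i lt)) ℓ<m)
    y-known : ∀ i → i < k → approxApp (code (prefix y m)) (code (prefix z ℓ)) i ≡ suc (b i)
    y-known i lt = approxApp-complete y z m ℓ i (b i) (hy i) (≤-trans (m≤m+n _ _) (costʸ≤ℓ i lt))
                     (≤-<-trans (≤-trans (m≤n+m _ (proj₁ (hy i))) (costʸ≤ℓ i lt)) ℓ<m)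
    x-long : suc q ≤ knownLengthAt x z n ℓ
    x-long = knownLength-lower _ _ m (suc q) (λ i lt → a i , x-known i lt) (≤-trans (s≤s q≤ℓ) ℓ<m)
    y-long : k ≤ knownLengthAt y z n ℓ
    y-long = knownLength-lower _ _ m k (λ i lt → b i , y-known i lt) (≤-trans k≤ℓ (<⇒≤ ℓ<m))
    defined : 𝐒₂ x y (code (n ∷ prefix z ℓ)) ≡ suc (w n)
    defined = trans (query ℓ) (approxApp-complete a b (knownLengthAt x z n ℓ) (knownLengthAt y z n ℓ) n (w n) (hab n) y-long x-long)

computable⇒PR₁ : ∀ {β} → Computable β → PR₁ β
computable⇒PR₁ (e , h) = mkPR e (λ { (t ∷ []) → h t })

PR₁⇒computable : ∀ {β} → PR₁ β → Computable β
PR₁⇒computable p = prog p , (λ t → ev p (t ∷ []))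

computable-≈ : ∀ {β β'} → Computable β → β ≈ β' → Computable β'
computable-≈ (e , h) eq = e , (λ t → subst (Eval e (t ∷ [])) (eq t) (h t))

-- The number of input digits needed for output n is found by μ-search.
Ap-computable : ∀ {α β y} → Computable α → Computable β → Ap α β y → Computable y
Ap-computable {α} {β} {y} ca cb (mkAp h) =
  PR₁⇒computable (isPR-resp result (comp-pr {f = uncurry₁ pred} {gs = answer ∷ []} pred-pr (answer-pr ∷ [])))
  where
  α-pr = computable⇒PR₁ ca
  prefixβ-pr : PR₁ (λ k → code (prefix β k))
  prefixβ-pr = isPR-resp (λ { (k ∷ []) → refl }) (prefixCode-pr {β = uncurry₁ β} (computable⇒PR₁ cb))
  silent : Vec ℕ 2 → ℕ
  silent (k ∷ n ∷ []) = isZero (α (suc (cantor n (code (prefix β k)))))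
  silent-pr : IsPR silent
  silent-pr = isPR-resp (λ { (k ∷ n ∷ []) → refl })
    (expr-pr (call₁ isZero-pr (call₁ α-pr (call₁ suc-pr (call₂ cantor-pr arg₁ (call₁ prefixβ-pr arg₀))))))
  inputLength : Vec ℕ 1 → ℕ
  inputLength (n ∷ []) = proj₁ (h n)
  inputLength-pr : IsPR inputLength
  inputLength-pr = mu-pr {f = silent} silent-pr (λ { (n ∷ []) → cong isZero (proj₁ (proj₂ (h n))) })
    (λ { (n ∷ []) j lt → 0 , cong isZero (proj₂ (proj₂ (h n)) j lt) })
  query : Vec ℕ 1 → ℕ
  query v = suc (cantor (lookup v zero) (code (prefix β (inputLength v))))
  query-pr : IsPR query
  query-pr = comp-pr {f = uncurry₁ suc} {gs = _ ∷ []} suc-pr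
    (comp-pr {f = uncurry₂ cantor} {gs = (λ v → lookup v zero) ∷ (λ v → code (prefix β (inputLength v))) ∷ []} cantor-pr
      (proj-pr zero ∷ comp-pr {f = uncurry₁ (λ k → code (prefix β k))} {gs = inputLength ∷ []} prefixβ-pr (inputLength-pr ∷ []) ∷ []) ∷ [])
  answer : Vec ℕ 1 → ℕ
  answer (n ∷ []) = α (suc (cantor n (code (prefix β (proj₁ (h n))))))
  answer-pr : IsPR answer
  answer-pr = isPR-resp (λ { (n ∷ []) → refl }) (comp-pr {f = uncurry₁ α} {gs = query ∷ []} α-pr (query-pr ∷ []))
  result : ∀ v → pred (answer v) ≡ uncurry₁ y v
  result (n ∷ []) = cong pred (proj₁ (proj₂ (h n)))

bullet-computable : Computable bullet
bullet-computable = zeroF , (λ t → ev-zero)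

𝐈 : Baire
𝐈 = reading suc (λ n X → nth X n)

𝐈-pr : PR₁ 𝐈
𝐈-pr = reading-pr suc-pr (byExpr₂ (call₂ nth-pr arg₁ arg₀) (λ _ _ → refl))

𝐈-app : ∀ x → Ap 𝐈 x x
𝐈-app x = reading-app _ _ x x (λ n → sym (nth-prefix x (suc n) n ≤-refl))

𝐅 : Baire
𝐅 = 𝐊₁ 𝐈

𝐅-pr : PR₁ 𝐅
𝐅-pr = byExpr₁ (call₁ suc-pr (call₁ 𝐈-pr (call₁ hd-pr arg₀))) (λ _ → refl)

-- branch · w is 𝐊 or 𝐅 = 𝐊 · 𝐈 according to whether w 0 is zero, so
-- branch · w · f · g selects f or g.
branchOn : Baire → Baire
branchOn w n = ifz (w 0) (𝐊 n) (𝐅 n)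

branch : Baire
branch = reading (λ _ → 1) (λ n W → ifz (nth W 0) (𝐊 n) (𝐅 n))

branch-pr : PR₁ branch
branch-pr = reading-pr (byExpr₁ (lit 1) (λ _ → refl)) (byExpr₂ (call₃ ifz-pr (call₂ nth-pr arg₁ (lit 0)) (call₁ 𝐊-pr arg₀) (call₁ 𝐅-pr arg₀)) (λ _ _ → refl))

branch-app : ∀ w → Ap branch w (branchOn w)
branch-app w = reading-app _ _ w (branchOn w) (λ n → cong (λ t → ifz t (𝐊 n) (𝐅 n)) (sym (nth-prefix w 1 0 (s≤s z≤n))))

branchOn-zero : ∀ w → w 0 ≡ 0 → branchOn w ≈ 𝐊
branchOn-zero w e n = cong (λ t → ifz t (𝐊 n) (𝐅 n)) e

branchOn-suc : ∀ w r → w 0 ≡ suc r → branchOn w ≈ 𝐅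
branchOn-suc w r e n = cong (λ t → ifz t (𝐊 n) (𝐅 n)) e

consᶜ : ℕ → Baire
consᶜ a = reading (λ n → n) (λ n U → ifz n a (nth U (pred n)))

consᶜ-pr : ∀ a → PR₁ (consᶜ a)
consᶜ-pr a = reading-pr (byExpr₁ arg₀ (λ _ → refl)) (byExpr₂ (call₃ ifz-pr arg₀ (lit a) (call₂ nth-pr arg₁ (call₁ pred-pr arg₀))) (λ _ _ → refl))

consᶜ-app : ∀ a u → Ap (consᶜ a) u (cons a u)
consᶜ-app a u = reading-app _ _ u (cons a u) h
  where
  h : ∀ n → cons a u n ≡ ifz n a (nth (code (prefix u n)) (pred n))
  h zero = refl
  h (suc n) = sym (nth-prefix u (suc n) n ≤-refl)

tailᶜ : Baire
tailᶜ = reading (λ n → suc (suc n)) (λ n X → nth X (suc n))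

tailᶜ-pr : PR₁ tailᶜ
tailᶜ-pr = reading-pr (byExpr₁ (call₁ suc-pr (call₁ suc-pr arg₀)) (λ _ → refl)) (byExpr₂ (call₂ nth-pr arg₁ (call₁ suc-pr arg₀)) (λ _ _ → refl))

tailᶜ-app : ∀ x → Ap tailᶜ x (λ n → x (suc n))
tailᶜ-app x = reading-app _ _ x _ (λ n → sym (nth-prefix x (suc (suc n)) (suc n) ≤-refl))

interleave-even : ∀ (u v : Baire) n → interleave u v (n + n) ≡ u n
interleave-even u v zero = refl
interleave-even u v (suc n) rewrite +-suc n n = interleave-even (λ k → u (suc k)) (λ k → v (suc k)) n

interleave-odd : ∀ (u v : Baire) n → interleave u v (suc (n + n)) ≡ v n
interleave-odd u v zero = refl
interleave-odd u v (suc n) rewrite +-suc n n = interleave-odd (λ k → u (suc k)) (λ k → v (suc k)) n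

fstᶜ : Baire
fstᶜ = reading (λ n → suc (suc (n + n))) (λ n X → nth X (suc (n + n)))

sndᶜ : Baire
sndᶜ = reading (λ n → suc (suc (suc (n + n)))) (λ n X → nth X (suc (suc (n + n))))

fstᶜ-pr : PR₁ fstᶜ
fstᶜ-pr = reading-pr (byExpr₁ (call₁ suc-pr (call₁ suc-pr (call₂ +-pr arg₀ arg₀))) (λ _ → refl)) (byExpr₂ (call₂ nth-pr arg₁ (call₁ suc-pr (call₂ +-pr arg₀ arg₀))) (λ _ _ → refl))

sndᶜ-pr : PR₁ sndᶜ
sndᶜ-pr = reading-pr (byExpr₁ (call₁ suc-pr (call₁ suc-pr (call₁ suc-pr (call₂ +-pr arg₀ arg₀)))) (λ _ → refl))
                  (byExpr₂ (call₂ nth-pr arg₁ (call₁ suc-pr (call₁ suc-pr (call₂ +-pr arg₀ arg₀)))) (λ _ _ → refl))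

fst : Baire → Baire
fst w n = w (suc (n + n))
snd : Baire → Baire
snd w n = w (suc (suc (n + n)))

fstᶜ-app : ∀ w → Ap fstᶜ w (fst w)
fstᶜ-app w = reading-app _ _ w _ (λ n → sym (nth-prefix w _ _ ≤-refl))

sndᶜ-app : ∀ w → Ap sndᶜ w (snd w)
sndᶜ-app w = reading-app _ _ w _ (λ n → sym (nth-prefix w _ _ ≤-refl))

fst-pair : ∀ u v → fst (pair u v) ≈ u
fst-pair u v n = interleave-even u v n

snd-pair : ∀ u v → snd (pair u v) ≈ v
snd-pair u v n = interleave-odd u v n

parity : ℕ → ℕ
parity zero = 0
parity (suc n) = ifz (parity n) 1 0

half : ℕ → ℕ
half zero = 0
half (suc n) = half n + parity n

parity-pr : PR₁ parity
parity-pr = PR₁-natrec 0 {h = λ n r → ifz r 1 0} (byExpr₂ (call₃ ifz-pr arg₁ (lit 1) (lit 0)) (λ _ _ → refl)) refl (λ n → refl)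

half-pr : PR₁ half
half-pr = PR₁-natrec 0 {h = λ n r → r + parity n} (byExpr₂ (call₂ +-pr arg₁ (call₁ parity-pr arg₀)) (λ _ _ → refl)) refl (λ n → refl)

parity-01 : ∀ n → parity n ≡ 0 ⊎ parity n ≡ 1
parity-01 zero = inj₁ refl
parity-01 (suc n) with parity n | parity-01 n
... | zero | _ = inj₂ refl
... | suc _ | _ = inj₁ refl

half-≤ : ∀ n → half n ≤ n
half-≤ zero = z≤n
half-≤ (suc n) with parity n | parity-01 n
... | zero | _ = ≤-trans (≤-reflexive (+-identityʳ (half n))) (≤-trans (half-≤ n) (n≤1+n n))
... | suc zero | _ = ≤-trans (≤-reflexive (+-comm (half n) 1)) (s≤s (half-≤ n))
... | suc (suc _) | inj₁ ()
... | suc (suc _) | inj₂ ()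

parity-+2 : ∀ n → parity (suc (suc n)) ≡ parity n
parity-+2 n with parity n | parity-01 n
... | zero | _ = refl
... | suc zero | _ = refl
... | suc (suc _) | inj₁ ()
... | suc (suc _) | inj₂ ()

half-+2 : ∀ n → half (suc (suc n)) ≡ suc (half n)
half-+2 n with parity n | parity-01 n
... | zero | _ = trans (cong (_+ 1) (+-identityʳ (half n))) (+-comm (half n) 1)
... | suc zero | _ = trans (+-identityʳ _) (+-comm (half n) 1)
... | suc (suc _) | inj₁ ()
... | suc (suc _) | inj₂ ()

interleave-parity : ∀ (u v : Baire) k → interleave u v k ≡ ifz (parity k) (u (half k)) (v (half k))
interleave-parity u v zero = refl
interleave-parity u v (suc zero) = refl
interleave-parity u v (suc (suc k)) rewrite parity-+2 k | half-+2 k = interleave-parity (λ k → u (suc k)) (λ k → v (suc k)) k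

-- pair u v lists 1, u 0, v 0, u 1, v 1, …, so position n + 1 holds u (half n)
-- or v (half n) according to the parity of n.
pairStep : Baire → ℕ → ℕ → ℕ
pairStep u n V = ifz n 1 (ifz (parity (pred n)) (u (half (pred n))) (nth V (half (pred n))))

pairStepᶜ : ℕ → ℕ → ℕ → ℕ
pairStepᶜ n U V = ifz n 1 (ifz (parity (pred n)) (nth U (half (pred n))) (nth V (half (pred n))))

pairStepᶜ-pr : PR₃ pairStepᶜ
pairStepᶜ-pr = byExpr₃ (call₃ ifz-pr arg₀ (lit 1) (call₃ ifz-pr (call₁ parity-pr (call₁ pred-pr arg₀)) (call₂ nth-pr arg₁ (call₁ half-pr (call₁ pred-pr arg₀)))
                                                                         (call₂ nth-pr arg₂ (call₁ half-pr (call₁ pred-pr arg₀))))) (λ _ _ _ → refl)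

pair₁ : Baire → Baire
pair₁ u = reading (λ n → n) (pairStep u)

pairᶜ : Baire
pairᶜ = reading hd (λ m U → ifz (suc (len (tl m)) ∸ hd m) 0 (suc (pairStepᶜ (hd m) U (tl m))))

pairᶜ-pr : PR₁ pairᶜ
pairᶜ-pr = reading-pr hd-pr (byExpr₂ (call₃ ifz-pr (call₂ ∸-pr (call₁ suc-pr (call₁ len-pr (call₁ tl-pr arg₀))) (call₁ hd-pr arg₀)) (lit 0)
                      (call₁ suc-pr (call₃ pairStepᶜ-pr (call₁ hd-pr arg₀) arg₁ (call₁ tl-pr arg₀)))) (λ _ _ → refl))

pairStep-prefix : ∀ u n V → pairStep u n V ≡ pairStepᶜ n (code (prefix u n)) V
pairStep-prefix u zero V = refl
pairStep-prefix u (suc n) V = cong (λ t → ifz (parity n) t (nth V (half n))) (sym (nth-prefix u (suc n) (half n) (s≤s (half-≤ n))))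

pairᶜ-app : ∀ u → Ap pairᶜ u (pair₁ u)
pairᶜ-app u = reading-app hd (λ m U → ifz (suc (len (tl m)) ∸ hd m) 0 (suc (pairStepᶜ (hd m) U (tl m)))) u (pair₁ u)
  (λ m → trans (reading-def (λ n → n) (pairStep u) m) (cong (λ t → ifz (suc (len (tl m)) ∸ hd m) 0 (suc t)) (pairStep-prefix u (hd m) (tl m))))

pair₁-app : ∀ u v → Ap (pair₁ u) v (pair u v)
pair₁-app u v = reading-app _ _ v (pair u v) h
  where
  h : ∀ n → pair u v n ≡ pairStep u n (code (prefix v n))
  h zero = refl
  h (suc n) = trans (interleave-parity u v n) (cong (λ t → ifz (parity n) (u (half n)) t) (sym (nth-prefix v (suc n) (half n) (s≤s (half-≤ n)))))

≈-refl : ∀ {u} → u ≈ u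
≈-refl n = refl
≈-sym : ∀ {u v} → u ≈ v → v ≈ u
≈-sym e n = sym (e n)
≈-trans : ∀ {u v w} → u ≈ v → v ≈ w → u ≈ w
≈-trans e f n = trans (e n) (f n)

pair-inj : ∀ {u v u' v'} → pair u v ≈ pair u' v' → (u ≈ u') × (v ≈ v')
pair-inj {u} {v} {u'} {v'} e = (λ k → trans (sym (fst-pair u v k)) (trans (e (suc (k + k))) (fst-pair u' v' k))) ,
                               (λ k → trans (sym (snd-pair u v k)) (trans (e (suc (suc (k + k)))) (snd-pair u' v' k)))

pair≉bullet : ∀ {u v} → pair u v ≈ bullet → ⊥
pair≉bullet e = 1+n≢0 (e 0)

cons-inj : ∀ {a b u v} → cons a u ≈ cons b v → (a ≡ b) × (u ≈ v)
cons-inj e = e 0 , (λ k → e (suc k))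

in₁≉in₂ : ∀ {u v} → in₁ u ≈ in₂ v → ⊥
in₁≉in₂ e = 0≢1+n (e 0)

interleave-cong : ∀ n {u v u' v'} → u ≈ u' → v ≈ v' → interleave u v n ≡ interleave u' v' n
interleave-cong zero eu ev = eu 0
interleave-cong (suc zero) eu ev = ev 0
interleave-cong (suc (suc n)) eu ev = interleave-cong n (λ k → eu (suc k)) (λ k → ev (suc k))

pair-cong : ∀ {u v u' v'} → u ≈ u' → v ≈ v' → pair u v ≈ pair u' v'
pair-cong eu ev zero = refl
pair-cong eu ev (suc n) = interleave-cong n eu ev

cons-cong : ∀ {a u u'} → u ≈ u' → cons a u ≈ cons a u'
cons-cong e zero = refl
cons-cong e (suc n) = e n

sol⋆P-≈ : ∀ {Q R w w' p} → w ≈ w' → Sol (Q ⋆P R) w p → Sol (Q ⋆P R) w' p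
sol⋆P-≈ e (u , c , e' , rest) = u , c , ≈-trans (≈-sym e) e' , rest

sol⊓P-≈ : ∀ {Q R w w' p} → w ≈ w' → Sol (Q ⊓P R) w p → Sol (Q ⊓P R) w' p
sol⊓P-≈ e (u , c , e' , rest) = u , c , ≈-trans (≈-sym e) e' , rest

solD-≈ : ∀ {R w w' z} → w ≈ w' → SolD R w z → SolD R w' z
solD-≈ e (leafS w z eb ez) = leafS _ z (≈-trans (≈-sym e) eb) ez
solD-≈ e (nodeS w z u c x v y ew s a sd ez) = nodeS _ z u c x v y (≈-trans (≈-sym e) ew) s a sd ez

SolExt : Problem → Set
SolExt P = ∀ u u' x x' → u ≈ u' → x ≈ x' → Sol P u x → Sol P u' x'

Constant : Set
Constant = Σ Baire Computable

infixl 9 _·_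
data Tm (n : ℕ) : Set where
  var : Fin n → Tm n
  cst : Constant → Tm n
  _·_ : Tm n → Tm n → Tm n

data _⊢_⇓_ {n : ℕ} (E : Vec Baire n) : Tm n → Baire → Set where
  ⇓var : ∀ {i y} → lookup E i ≈ y → E ⊢ var i ⇓ y
  ⇓cst : ∀ {c y} → proj₁ c ≈ y → E ⊢ cst c ⇓ y
  ⇓app : ∀ {t s a b y} → E ⊢ t ⇓ a → E ⊢ s ⇓ b → Ap a b y → E ⊢ t · s ⇓ y

⇓v : ∀ {n} {E : Vec Baire n} {i} → E ⊢ var i ⇓ lookup E i
⇓v = ⇓var ≈-refl
⇓c : ∀ {n} {E : Vec Baire n} {c} → E ⊢ cst c ⇓ proj₁ c
⇓c = ⇓cst ≈-refl

AllComputable : ∀ {n} → Vec Baire n → Set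
AllComputable E = ∀ i → Computable (lookup E i)

⇓-computable : ∀ {n} {E : Vec Baire n} {t y} → AllComputable E → E ⊢ t ⇓ y → Computable y
⇓-computable {E = E} ce (⇓var {i} h) = computable-≈ (ce i) h
⇓-computable ce (⇓cst {c} h) = computable-≈ (proj₂ c) h
⇓-computable ce (⇓app ht hs ab) = Ap-computable (⇓-computable ce ht) (⇓-computable ce hs) ab

allComputable-[] : AllComputable []
allComputable-[] ()

allComputable-∷ : ∀ {n} {x} {E : Vec Baire n} → Computable x → AllComputable E → AllComputable (x ∷ E)
allComputable-∷ cx ce zero = cx
allComputable-∷ cx ce (suc i) = ce i

𝐊T : ∀ {n} → Tm n
𝐊T = cst (𝐊 , PR₁⇒computable 𝐊-pr)
𝐒T : ∀ {n} → Tm n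
𝐒T = cst (𝐒 , PR₁⇒computable 𝐒-pr)
bulletT : ∀ {n} → Tm n
bulletT = cst (bullet , bullet-computable)

lam : ∀ {n} → Tm (suc n) → Tm n
lam (var zero) = 𝐒T · 𝐊T · 𝐊T
lam (var (suc i)) = 𝐊T · var i
lam (cst c) = 𝐊T · cst c
lam (t · s) = 𝐒T · lam t · lam s

lam-correct : ∀ {n} (t : Tm (suc n)) (E : Vec Baire n) →
  Σ Baire λ f → (E ⊢ lam t ⇓ f) × (∀ x y → (x ∷ E) ⊢ t ⇓ y → Ap f x y)
lam-correct (var zero) E = 𝐒₂ 𝐊 𝐊 , ⇓app (⇓app ⇓c ⇓c (𝐒-app 𝐊)) ⇓c (𝐒₁-app 𝐊 𝐊) ,
  λ { x y (⇓var e) → Ap-≈-result (𝐒₂-app (𝐊-app x) (𝐊-app x) (𝐊₁-app x (𝐊₁ x))) e }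
lam-correct (var (suc i)) E = 𝐊₁ (lookup E i) , ⇓app ⇓c ⇓v (𝐊-app _) , λ { x y (⇓var e) → Ap-≈-result (𝐊₁-app _ x) e }
lam-correct (cst c) E = 𝐊₁ (proj₁ c) , ⇓app ⇓c ⇓c (𝐊-app _) , λ { x y (⇓cst e) → Ap-≈-result (𝐊₁-app _ x) e }
lam-correct (t · s) E with lam-correct t E | lam-correct s E
... | (f1 , h1 , a1) | (f2 , h2 , a2) = 𝐒₂ f1 f2 , ⇓app (⇓app ⇓c h1 (𝐒-app f1)) h2 (𝐒₁-app f1 f2) ,
  λ { x y (⇓app {a = a} {b} ta sb ab) → 𝐒₂-app (a1 x a ta) (a2 x b sb) ab }

lamValue : ∀ {n} (t : Tm (suc n)) (E : Vec Baire n) → Baire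
lamValue t E = proj₁ (lam-correct t E)

lam⇓ : ∀ {n} (t : Tm (suc n)) (E : Vec Baire n) → E ⊢ lam t ⇓ lamValue t E
lam⇓ t E = proj₁ (proj₂ (lam-correct t E))

lam-app : ∀ {n} (t : Tm (suc n)) (E : Vec Baire n) x y → (x ∷ E) ⊢ t ⇓ y → Ap (lamValue t E) x y
lam-app t E = proj₂ (proj₂ (lam-correct t E))

lam-computable : ∀ {n} (t : Tm (suc n)) (E : Vec Baire n) → AllComputable E → Computable (lamValue t E)
lam-computable t E ce = ⇓-computable ce (lam⇓ t E)

x0 : ∀ {n} → Tm (suc n)
x0 = var zero
x1 : ∀ {n} → Tm (suc (suc n))
x1 = var (suc zero)
x2 : ∀ {n} → Tm (suc (suc (suc n)))
x2 = var (suc (suc zero))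
x3 : ∀ {n} → Tm (suc (suc (suc (suc n))))
x3 = var (suc (suc (suc zero)))
x4 : ∀ {n} → Tm (suc (suc (suc (suc (suc n)))))
x4 = var (suc (suc (suc (suc zero))))

-- Turing's fixed point: with W = λ x f. f (λ w. x x f w) and f = λ Φ w. body,
-- Φ = λ w. W W f w satisfies Φ w = f Φ w.
fixpoint : (body : Tm 2) → Σ Baire λ Φ → Computable Φ × (∀ w y → (w ∷ Φ ∷ []) ⊢ body ⇓ y → Ap Φ w y)
fixpoint body = Φ , Φ-computable , Φ-app
  where
  f = lamValue (lam body) []
  f-computable : Computable f
  f-computable = lam-computable (lam body) [] allComputable-[]
  unrolled : Tm 3
  unrolled = x2 · x2 · x1 · x0
  WT : Tm 1
  WT = lam (x0 · lam unrolled)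
  W = lamValue WT []
  W-computable : Computable W
  W-computable = lam-computable WT [] allComputable-[]
  Φ = lamValue unrolled (f ∷ W ∷ [])
  Φ-computable : Computable Φ
  Φ-computable = lam-computable unrolled (f ∷ W ∷ []) (allComputable-∷ f-computable (allComputable-∷ W-computable allComputable-[]))
  Φ-app : ∀ w y → (w ∷ Φ ∷ []) ⊢ body ⇓ y → Ap Φ w y
  Φ-app w y hb = lam-app unrolled (f ∷ W ∷ []) w y
    (⇓app (⇓app (⇓app ⇓v ⇓v (lam-app WT [] W _ (lam⇓ (x0 · lam unrolled) (W ∷ [])))) ⇓v
                  (lam-app (x0 · lam unrolled) (W ∷ []) f _
                     (⇓app ⇓v (lam⇓ unrolled (f ∷ W ∷ [])) (lam-app (lam body) [] Φ _ (lam⇓ body (Φ ∷ []))))))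
          ⇓v (lam-app body (Φ ∷ []) w y hb))

Answers : (P Q : Problem) → Tm 1 → Baire → Baire → Set
Answers P Q bwd u v = ∀ y → Sol Q v y → Σ Baire λ z → ((pair u y ∷ []) ⊢ bwd ⇓ z) × Sol P u z

ReducesVia : (P Q : Problem) → Tm 1 → Tm 1 → Set
ReducesVia P Q fwd bwd = ∀ u → Dom P u → Σ Baire λ v → ((u ∷ []) ⊢ fwd ⇓ v) × Dom Q v × Answers P Q bwd u v

≤W-fromTerms : ∀ {P Q : Problem} (fwd bwd : Tm 1) → ReducesVia P Q fwd bwd → P ≤W Q
≤W-fromTerms fwd bwd h = lamValue fwd [] , lamValue bwd [] , lam-computable fwd [] allComputable-[] , lam-computable bwd [] allComputable-[] ,
  λ u du → let (v , ev , dv , back) = h u du in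
    v , unAp (lam-app fwd [] u v ev) , dv , λ y sy → let (z , ez , sz) = back y sy in z , unAp (lam-app bwd [] (pair u y) z ez) , sz

-- The constants are named in where clauses: written inline, their computability
-- proofs get unfolded during unification, which makes checking infeasible.
pairT : ∀ {n} → Tm n → Tm n → Tm n
pairT a b = pairᵗ · a · b
  where
  pairᵗ = cst (pairᶜ , PR₁⇒computable pairᶜ-pr)
fstT : ∀ {n} → Tm n → Tm n
fstT a = fstᵗ · a
  where
  fstᵗ = cst (fstᶜ , PR₁⇒computable fstᶜ-pr)
sndT : ∀ {n} → Tm n → Tm n
sndT a = sndᵗ · a
  where
  sndᵗ = cst (sndᶜ , PR₁⇒computable sndᶜ-pr)
in1T : ∀ {n} → Tm n → Tm n
in1T a = in₁ᵗ · a
  where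
  in₁ᵗ = cst (consᶜ 0 , PR₁⇒computable (consᶜ-pr 0))
in2T : ∀ {n} → Tm n → Tm n
in2T a = in₂ᵗ · a
  where
  in₂ᵗ = cst (consᶜ 1 , PR₁⇒computable (consᶜ-pr 1))
tailT : ∀ {n} → Tm n → Tm n
tailT a = tailᵗ · a
  where
  tailᵗ = cst (tailᶜ , PR₁⇒computable tailᶜ-pr)
caseT : ∀ {n} → Tm n → Tm n → Tm n → Tm n → Tm n
caseT t f g a = branchᵗ · t · f · g · a
  where
  branchᵗ = cst (branch , PR₁⇒computable branch-pr)

module _ {n : ℕ} {E : Vec Baire n} where

  ⇓pair : ∀ {s t u v} → E ⊢ s ⇓ u → E ⊢ t ⇓ v → E ⊢ pairT s t ⇓ pair u v
  ⇓pair {u = u} {v} hs ht = ⇓app (⇓app ⇓c hs (pairᶜ-app u)) ht (pair₁-app u v)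

  ⇓fst : ∀ {s w u v} → E ⊢ s ⇓ w → w ≈ pair u v → E ⊢ fstT s ⇓ u
  ⇓fst {w = w} {u} {v} hs e = ⇓app ⇓c hs (Ap-≈-result (fstᶜ-app w) (λ k → trans (e (suc (k + k))) (fst-pair u v k)))

  ⇓snd : ∀ {s w u v} → E ⊢ s ⇓ w → w ≈ pair u v → E ⊢ sndT s ⇓ v
  ⇓snd {w = w} {u} {v} hs e = ⇓app ⇓c hs (Ap-≈-result (sndᶜ-app w) (λ k → trans (e (suc (suc (k + k)))) (snd-pair u v k)))

  ⇓in₁ : ∀ {s u} → E ⊢ s ⇓ u → E ⊢ in1T s ⇓ in₁ u
  ⇓in₁ {u = u} hs = ⇓app ⇓c hs (consᶜ-app 0 u)

  ⇓in₂ : ∀ {s u} → E ⊢ s ⇓ u → E ⊢ in2T s ⇓ in₂ u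
  ⇓in₂ {u = u} hs = ⇓app ⇓c hs (consᶜ-app 1 u)

  ⇓tail : ∀ {s w a u} → E ⊢ s ⇓ w → w ≈ cons a u → E ⊢ tailT s ⇓ u
  ⇓tail {w = w} hs e = ⇓app ⇓c hs (Ap-≈-result (tailᶜ-app w) (λ k → e (suc k)))

  ⇓case-zero : ∀ {t f g a w F G x r} → E ⊢ t ⇓ w → w 0 ≡ 0 → E ⊢ f ⇓ F → E ⊢ g ⇓ G → E ⊢ a ⇓ x → Ap F x r →
    E ⊢ caseT t f g a ⇓ r
  ⇓case-zero {w = w} {F} {G} ht e hf hg ha hFx =
    ⇓app (⇓app (⇓app (⇓app ⇓c ht (branch-app w)) hf (Ap-≈-fun (𝐊-app F) (≈-sym (branchOn-zero w e)))) hg (𝐊₁-app F G)) ha hFx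

  ⇓case-suc : ∀ {t f g a w F G x r k} → E ⊢ t ⇓ w → w 0 ≡ suc k → E ⊢ f ⇓ F → E ⊢ g ⇓ G → E ⊢ a ⇓ x → Ap G x r →
    E ⊢ caseT t f g a ⇓ r
  ⇓case-suc {w = w} {F} {G} {k = k} ht e hf hg ha hGx =
    ⇓app (⇓app (⇓app (⇓app ⇓c ht (branch-app w)) hf (Ap-≈-fun (𝐊₁-app 𝐈 F) (≈-sym (branchOn-suc w k e)))) hg (𝐈-app G)) ha hGx

forwardT : ∀ {n} {P Q : Problem} → P ≤W Q → Tm n
forwardT r = cst (proj₁ r , proj₁ (proj₂ (proj₂ r)))
backwardT : ∀ {n} {P Q : Problem} → P ≤W Q → Tm n
backwardT r = cst (proj₁ (proj₂ r) , proj₁ (proj₂ (proj₂ (proj₂ r))))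

≤W-apply : ∀ {P Q : Problem} (r : P ≤W Q) u → Dom P u → Σ Baire λ v → Ap (proj₁ r) u v × Dom Q v ×
     (∀ y → Sol Q v y → Σ Baire λ z → Ap (proj₁ (proj₂ r)) (pair u y) z × Sol P u z)
≤W-apply r u du = let (v , a , dv , b) = proj₂ (proj₂ (proj₂ (proj₂ r))) u du in
  v , mkAp a , dv , λ y sy → let (z , ad , sz) = b y sy in z , mkAp ad , sz

≤W-refl : ∀ {P} → P ≤W P
≤W-refl = ≤W-fromTerms x0 (sndT x0) λ u du → u , ⇓v , du , λ y sy → y , ⇓snd ⇓v ≈-refl , sy

≤W-trans : ∀ {P Q R} → P ≤W Q → Q ≤W R → P ≤W R
≤W-trans r1 r2 = ≤W-fromTerms (forwardT r2 · (forwardT r1 · x0)) (backwardT r1 · pairT (fstT x0) (backwardT r2 · pairT (forwardT r1 · fstT x0) (sndT x0)))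
  λ u du → let (v1 , a1 , dv1 , b1) = ≤W-apply r1 u du in let (v , a2 , dv , b2) = ≤W-apply r2 v1 dv1 in
    v , ⇓app ⇓c (⇓app ⇓c ⇓v a1) a2 , dv ,
    λ y sy → let (z2 , ad2 , sz2) = b2 y sy in let (z , ad1 , sz) = b1 z2 sz2 in
      z , ⇓app ⇓c (⇓pair (⇓fst ⇓v ≈-refl) (⇓app ⇓c (⇓pair (⇓app ⇓c (⇓fst ⇓v ≈-refl) a1) (⇓snd ⇓v ≈-refl)) ad2)) ad1 , sz

𝟘P-least : ∀ {P} → 𝟘P ≤W P
𝟘P-least = ≤W-fromTerms x0 x0 (λ u ())

⊤P-greatest : ∀ {P} → P ≤W ⊤P
⊤P-greatest = ≤W-fromTerms bulletT x0 (λ u du → bullet , ⇓c , ≈-refl , λ y ())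

⊔P-upperˡ : ∀ {P Q} → SolExt P → P ≤W (P ⊔P Q)
⊔P-upperˡ {P} {Q} sx = ≤W-fromTerms (in1T x0) (sndT x0) λ u du → in₁ u , ⇓in₁ ⇓v , inj₁ (u , ≈-refl , du) , back u
  where
  back : ∀ u → Answers P (P ⊔P Q) (sndT x0) u (in₁ u)
  back u y (inj₁ (u' , e , s)) = y , ⇓snd ⇓v ≈-refl , sx u' u y y (≈-sym (proj₂ (cons-inj e))) ≈-refl s
  back u y (inj₂ (v , e , s)) = ⊥-elim (in₁≉in₂ e)

⊔P-upperʳ : ∀ {P Q} → SolExt Q → Q ≤W (P ⊔P Q)
⊔P-upperʳ {P} {Q} sx = ≤W-fromTerms (in2T x0) (sndT x0) λ u du → in₂ u , ⇓in₂ ⇓v , inj₂ (u , ≈-refl , du) , back u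
  where
  back : ∀ u → Answers Q (P ⊔P Q) (sndT x0) u (in₂ u)
  back u y (inj₂ (u' , e , s)) = y , ⇓snd ⇓v ≈-refl , sx u' u y y (≈-sym (proj₂ (cons-inj e))) ≈-refl s
  back u y (inj₁ (v , e , s)) = ⊥-elim (in₁≉in₂ (≈-sym e))

⊔P-least : ∀ {P Q R} → P ≤W R → Q ≤W R → (P ⊔P Q) ≤W R
⊔P-least {P} {Q} {R} r1 r2 = ≤W-fromTerms fwd bwd reduce
  where
  fwd bwd : Tm 1
  fwd₁T fwd₂T bwd₁T bwd₂T : Tm 2
  fwd₁T = forwardT r1 · tailT x0
  fwd₂T = forwardT r2 · tailT x0
  fwd = caseT x0 (lam fwd₁T) (lam fwd₂T) x0
  bwd₁T = backwardT r1 · pairT (tailT (fstT x0)) (sndT x0)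
  bwd₂T = backwardT r2 · pairT (tailT (fstT x0)) (sndT x0)
  bwd = caseT (fstT x0) (lam bwd₁T) (lam bwd₂T) x0
  reduce : ReducesVia (P ⊔P Q) R fwd bwd
  reduce w (inj₁ (u , e , du)) = let (v , a , dv , b) = ≤W-apply r1 u du in
    v , ⇓case-zero ⇓v (e 0) (lam⇓ fwd₁T (w ∷ [])) (lam⇓ fwd₂T (w ∷ [])) ⇓v (lam-app fwd₁T (w ∷ []) w v (⇓app ⇓c (⇓tail ⇓v e) a)) , dv ,
    λ y sy → let (z , ad , sz) = b y sy in
      z , ⇓case-zero (⇓fst ⇓v ≈-refl) (e 0) (lam⇓ bwd₁T (pair w y ∷ [])) (lam⇓ bwd₂T (pair w y ∷ [])) ⇓v
            (lam-app bwd₁T (pair w y ∷ []) (pair w y) z (⇓app ⇓c (⇓pair (⇓tail (⇓fst ⇓v ≈-refl) e) (⇓snd ⇓v ≈-refl)) ad)) ,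
      inj₁ (u , e , sz)
  reduce w (inj₂ (u , e , du)) = let (v , a , dv , b) = ≤W-apply r2 u du in
    v , ⇓case-suc ⇓v (e 0) (lam⇓ fwd₁T (w ∷ [])) (lam⇓ fwd₂T (w ∷ [])) ⇓v (lam-app fwd₂T (w ∷ []) w v (⇓app ⇓c (⇓tail ⇓v e) a)) , dv ,
    λ y sy → let (z , ad , sz) = b y sy in
      z , ⇓case-suc (⇓fst ⇓v ≈-refl) (e 0) (lam⇓ bwd₁T (pair w y ∷ [])) (lam⇓ bwd₂T (pair w y ∷ [])) ⇓v
            (lam-app bwd₂T (pair w y ∷ []) (pair w y) z (⇓app ⇓c (⇓pair (⇓tail (⇓fst ⇓v ≈-refl) e) (⇓snd ⇓v ≈-refl)) ad)) ,
      inj₂ (u , e , sz)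

⊓P-lowerˡ : ∀ {P Q} → (P ⊓P Q) ≤W P
⊓P-lowerˡ = ≤W-fromTerms (fstT x0) (in1T (sndT x0)) λ { w (u , v , e , du , dv) →
  u , ⇓fst ⇓v e , du , λ y sy → in₁ y , ⇓in₁ (⇓snd ⇓v ≈-refl) , (u , v , e , inj₁ (y , ≈-refl , sy)) }

⊓P-lowerʳ : ∀ {P Q} → (P ⊓P Q) ≤W Q
⊓P-lowerʳ = ≤W-fromTerms (sndT x0) (in2T (sndT x0)) λ { w (u , v , e , du , dv) →
  v , ⇓snd ⇓v e , dv , λ y sy → in₂ y , ⇓in₂ (⇓snd ⇓v ≈-refl) , (u , v , e , inj₂ (y , ≈-refl , sy)) }

⊓P-greatest : ∀ {P Q R} → SolExt Q → SolExt R → P ≤W Q → P ≤W R → P ≤W (Q ⊓P R)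
⊓P-greatest {P} {Q} {R} xq xr r1 r2 = ≤W-fromTerms fwd bwd reduce
  where
  fwd bwd : Tm 1
  bwd₁T bwd₂T : Tm 2
  fwd = pairT (forwardT r1 · x0) (forwardT r2 · x0)
  bwd₁T = backwardT r1 · pairT (fstT x0) (tailT (sndT x0))
  bwd₂T = backwardT r2 · pairT (fstT x0) (tailT (sndT x0))
  bwd = caseT (sndT x0) (lam bwd₁T) (lam bwd₂T) x0
  reduce : ReducesVia P (Q ⊓P R) fwd bwd
  reduce u du = let (v1 , a1 , dv1 , b1) = ≤W-apply r1 u du in let (v2 , a2 , dv2 , b2) = ≤W-apply r2 u du in
    pair v1 v2 , ⇓pair (⇓app ⇓c ⇓v a1) (⇓app ⇓c ⇓v a2) , (v1 , v2 , ≈-refl , dv1 , dv2) ,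
    λ { y (v1' , v2' , e , inj₁ (x , ey , sx)) →
      let (z , ad , sz) = b1 x (xq v1' v1 x x (≈-sym (proj₁ (pair-inj e))) ≈-refl sx) in
      z , ⇓case-zero (⇓snd ⇓v ≈-refl) (ey 0) (lam⇓ bwd₁T (pair u y ∷ [])) (lam⇓ bwd₂T (pair u y ∷ [])) ⇓v
            (lam-app bwd₁T (pair u y ∷ []) (pair u y) z (⇓app ⇓c (⇓pair (⇓fst ⇓v ≈-refl) (⇓tail (⇓snd ⇓v ≈-refl) ey)) ad)) , sz
      ; y (v1' , v2' , e , inj₂ (x , ey , sx)) →
      let (z , ad , sz) = b2 x (xr v2' v2 x x (≈-sym (proj₂ (pair-inj e))) ≈-refl sx) in
      z , ⇓case-suc (⇓snd ⇓v ≈-refl) (ey 0) (lam⇓ bwd₁T (pair u y ∷ [])) (lam⇓ bwd₂T (pair u y ∷ [])) ⇓v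
            (lam-app bwd₂T (pair u y ∷ []) (pair u y) z (⇓app ⇓c (⇓pair (⇓fst ⇓v ≈-refl) (⇓tail (⇓snd ⇓v ≈-refl) ey)) ad)) , sz }

⊓P-distribˡ-⊔P : ∀ {P Q R} → (P ⊓P (Q ⊔P R)) ≤W ((P ⊓P Q) ⊔P (P ⊓P R))
⊓P-distribˡ-⊔P {P} {Q} {R} = ≤W-fromTerms fwd (sndT x0) reduce
  where
  fwd : Tm 1
  inlT inrT : Tm 2
  inlT = in1T (pairT (fstT x0) (tailT (sndT x0)))
  inrT = in2T (pairT (fstT x0) (tailT (sndT x0)))
  fwd = caseT (sndT x0) (lam inlT) (lam inrT) x0
  reduce : ReducesVia (P ⊓P (Q ⊔P R)) ((P ⊓P Q) ⊔P (P ⊓P R)) fwd (sndT x0)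
  reduce W (u , w , e , du , inj₁ (v , ew , dv)) =
    in₁ (pair u v) , ⇓case-zero (⇓snd ⇓v e) (ew 0) (lam⇓ inlT (W ∷ [])) (lam⇓ inrT (W ∷ [])) ⇓v
       (lam-app inlT (W ∷ []) W _ (⇓in₁ (⇓pair (⇓fst ⇓v e) (⇓tail (⇓snd ⇓v e) ew)))) ,
    inj₁ (pair u v , ≈-refl , (u , v , ≈-refl , du , dv)) , back
    where
    back : Answers (P ⊓P (Q ⊔P R)) ((P ⊓P Q) ⊔P (P ⊓P R)) (sndT x0) W (in₁ (pair u v))
    back y (inj₂ (p , ep , _)) = ⊥-elim (in₁≉in₂ ep)
    back y (inj₁ (p , ep , (u' , v' , epp , inj₁ (x , ex , sx)))) =
      y , ⇓snd ⇓v ≈-refl , (u' , w , ≈-trans e (pair-cong (proj₁ (pair-inj (≈-trans (proj₂ (cons-inj ep)) epp))) ≈-refl) , inj₁ (x , ex , sx))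
    back y (inj₁ (p , ep , (u' , v' , epp , inj₂ (x , ex , sx)))) =
      y , ⇓snd ⇓v ≈-refl , (u , w , e , inj₂ (x , ex , inj₁ (v' , ≈-trans ew (cons-cong (proj₂ (pair-inj (≈-trans (proj₂ (cons-inj ep)) epp)))) , sx)))
  reduce W (u , w , e , du , inj₂ (v , ew , dv)) =
    in₂ (pair u v) , ⇓case-suc (⇓snd ⇓v e) (ew 0) (lam⇓ inlT (W ∷ [])) (lam⇓ inrT (W ∷ [])) ⇓v
       (lam-app inrT (W ∷ []) W _ (⇓in₂ (⇓pair (⇓fst ⇓v e) (⇓tail (⇓snd ⇓v e) ew)))) ,
    inj₂ (pair u v , ≈-refl , (u , v , ≈-refl , du , dv)) , back
    where
    back : Answers (P ⊓P (Q ⊔P R)) ((P ⊓P Q) ⊔P (P ⊓P R)) (sndT x0) W (in₂ (pair u v))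
    back y (inj₁ (p , ep , _)) = ⊥-elim (in₁≉in₂ (≈-sym ep))
    back y (inj₂ (p , ep , (u' , v' , epp , inj₁ (x , ex , sx)))) =
      y , ⇓snd ⇓v ≈-refl , (u' , w , ≈-trans e (pair-cong (proj₁ (pair-inj (≈-trans (proj₂ (cons-inj ep)) epp))) ≈-refl) , inj₁ (x , ex , sx))
    back y (inj₂ (p , ep , (u' , v' , epp , inj₂ (x , ex , sx)))) =
      y , ⇓snd ⇓v ≈-refl , (u , w , e , inj₂ (x , ex , inj₂ (v' , ≈-trans ew (cons-cong (proj₂ (pair-inj (≈-trans (proj₂ (cons-inj ep)) epp)))) , sx)))

⋆P-identityʳ-≤ : ∀ {P} → (P ⋆P 𝟙P) ≤W P
⋆P-identityʳ-≤ {P} = ≤W-fromTerms (sndT x0 · bulletT) (pairT bulletT (sndT x0)) λ { w (u , c , e , du , hc) →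
  let (v , a , dv) = hc bullet ≈-refl in
    v , ⇓app (⇓snd ⇓v e) ⇓c (mkAp a) , dv ,
    λ y sy → pair bullet y , ⇓pair ⇓c (⇓snd ⇓v ≈-refl) , (u , c , e , bullet , y , v , ≈-refl , ≈-refl , a , sy) }

⋆P-identityʳ-≥ : ∀ {P} → SolExt P → P ≤W (P ⋆P 𝟙P)
⋆P-identityʳ-≥ {P} xp = ≤W-fromTerms (pairT bulletT (𝐊T · x0)) (sndT (sndT x0)) λ u du →
  pair bullet (𝐊₁ u) , ⇓pair ⇓c (⇓app ⇓c ⇓v (𝐊-app u)) , (bullet , 𝐊₁ u , ≈-refl , ≈-refl , λ x ex → u , unAp (𝐊₁-app u x) , du) ,
  λ { y (u' , c' , e , x , y' , v' , ey , sx , a , sy') →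
      let ec = proj₂ (pair-inj e) in
      let ev' = Ap-det (Ap-≈-fun (mkAp a) (≈-sym ec)) (𝐊₁-app u x) in
      y' , ⇓snd (⇓snd ⇓v ≈-refl) ey , xp v' u y' y' ev' ≈-refl sy' }

⋆P-identityˡ-≤ : ∀ {P} → (𝟙P ⋆P P) ≤W P
⋆P-identityˡ-≤ {P} = ≤W-fromTerms (fstT x0) (pairT (sndT x0) bulletT) λ { w (u , c , e , du , hc) →
  u , ⇓fst ⇓v e , du , λ y sy → let (v' , a , dv') = hc y sy in
    pair y bullet , ⇓pair (⇓snd ⇓v ≈-refl) ⇓c , (u , c , e , y , bullet , v' , ≈-refl , sy , a , ≈-refl) }

⋆P-identityˡ-≥ : ∀ {P} → SolExt P → P ≤W (𝟙P ⋆P P)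
⋆P-identityˡ-≥ {P} xp = ≤W-fromTerms (pairT x0 (𝐊T · bulletT)) (fstT (sndT x0)) λ u du →
  pair u (𝐊₁ bullet) , ⇓pair ⇓v (⇓app ⇓c ⇓c (𝐊-app bullet)) , (u , 𝐊₁ bullet , ≈-refl , du , λ x sx → bullet , unAp (𝐊₁-app bullet x) , ≈-refl) ,
  λ { y (u' , c' , e , x , y' , v' , ey , sx , a , sy') →
      x , ⇓fst (⇓snd ⇓v ≈-refl) ey , xp u' u x x (≈-sym (proj₁ (pair-inj e))) ≈-refl sx }

⋆P-zeroʳ : ∀ {P} → (P ⋆P 𝟘P) ≤W 𝟘P
⋆P-zeroʳ = ≤W-fromTerms x0 x0 λ { w (u , c , e , () , h) }

⋆P-topʳ : ∀ {P} → ⊤P ≤W (P ⋆P ⊤P)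
⋆P-topʳ = ≤W-fromTerms (pairT bulletT bulletT) x0 λ u du → pair bullet bullet , ⇓pair ⇓c ⇓c , (bullet , bullet , ≈-refl , ≈-refl , λ x ()) ,
  λ { y (u' , c' , e , x , y' , v' , ey , () , a , sy') }

◇P-unit : ∀ {P} → 𝟙P ≤W (P ◇P)
◇P-unit = ≤W-fromTerms bulletT bulletT λ u du → bullet , ⇓c , leaf bullet ≈-refl , λ y sy → bullet , ⇓c , ≈-refl

◇P-unfold : ∀ {P} → ((P ◇P) ⋆P P) ≤W (P ◇P)
◇P-unfold {P} = ≤W-fromTerms x0 (sndT x0) λ { w (u , c , e , du , hc) →
  w , ⇓v , node w u c e du hc , λ { y (leafS .w .y eb ez) → ⊥-elim (pair≉bullet (≈-trans (≈-sym e) eb))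
                                 ; y (nodeS .w .y u' c' x v y' e' sx a sd ey) → y , ⇓snd ⇓v ≈-refl , (u' , c' , e' , x , y' , v , ey , sx , a , sd) } }

-- ⟨⟨u, k₁⟩, k⟩ ↦ ⟨u, λ x. ⟨k₁ x, λ y. k ⟨x, y⟩⟩⟩
⋆P-assoc⁻¹ : ∀ {P Q R} → SolExt R → (P ⋆P (Q ⋆P R)) ≤W ((P ⋆P Q) ⋆P R)
⋆P-assoc⁻¹ {P} {Q} {R} xr = ≤W-fromTerms fwd bwd reduce
  where
  innerT : Tm 3
  innerT = sndT x2 · pairT x1 x0
  contT : Tm 2
  contT = pairT (sndT (fstT x1) · x0) (lam innerT)
  fwd bwd : Tm 1
  fwd = pairT (fstT (fstT x0)) (lam contT)
  bwd = pairT (pairT (fstT (sndT x0)) (fstT (sndT (sndT x0)))) (sndT (sndT (sndT x0)))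
  reduce : ReducesVia (P ⋆P (Q ⋆P R)) ((P ⋆P Q) ⋆P R) fwd bwd
  reduce W (w , k , eW , (u , k1 , ew , du , hk1) , hk) = v , ⇓fwd , dom , back
    where
    cont = lamValue contT (W ∷ [])
    inner : Baire → Baire
    inner x = lamValue innerT (x ∷ W ∷ [])
    v = pair u cont
    ⇓fwd : (W ∷ []) ⊢ fwd ⇓ v
    ⇓fwd = ⇓pair (⇓fst (⇓fst ⇓v eW) ew) (lam⇓ contT (W ∷ []))
    mid : ∀ x → Sol R u x → Baire
    mid x sx = proj₁ (hk1 x sx)
    cont-app : ∀ x (sx : Sol R u x) → Ap cont x (pair (mid x sx) (inner x))
    cont-app x sx = lam-app contT (W ∷ []) x _ (⇓pair (⇓app (⇓snd (⇓fst ⇓v eW) ew) ⇓v (mkAp (proj₁ (proj₂ (hk1 x sx))))) (lam⇓ innerT (x ∷ W ∷ [])))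
    sol-QR : ∀ x (sx : Sol R u x) y q1' → mid x sx ≈ q1' → Sol Q q1' y → Sol (Q ⋆P R) w (pair x y)
    sol-QR x sx y q1' e sy = u , k1 , ew , x , y , q1' , ≈-refl , sx , unAp (Ap-≈-result (mkAp {k1} {x} (proj₁ (proj₂ (hk1 x sx)))) e) , sy
    inner-app : ∀ x (sx : Sol R u x) y (sy : Sol Q (mid x sx) y) → Ap (inner x) y (proj₁ (hk (pair x y) (sol-QR x sx y (mid x sx) ≈-refl sy)))
    inner-app x sx y sy = lam-app innerT (x ∷ W ∷ []) y _ (⇓app (⇓snd ⇓v eW) (⇓pair ⇓v ⇓v) (mkAp (proj₁ (proj₂ (hk (pair x y) (sol-QR x sx y (mid x sx) ≈-refl sy))))))
    dom : Dom ((P ⋆P Q) ⋆P R) v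
    dom = u , cont , ≈-refl , du , λ x sx → pair (mid x sx) (inner x) , unAp (cont-app x sx) ,
      (mid x sx , inner x , ≈-refl , proj₂ (proj₂ (hk1 x sx)) , λ y sy → _ , unAp (inner-app x sx y sy) , proj₂ (proj₂ (hk (pair x y) (sol-QR x sx y (mid x sx) ≈-refl sy))))
    back : Answers (P ⋆P (Q ⋆P R)) ((P ⋆P Q) ⋆P R) bwd W v
    back Y (u' , K2 , e , x , r , v' , eY , sx , aK , (q1' , K3 , e2 , y , t , vp' , et , sy , aK3 , st)) =
      pair (pair x y) t ,
      ⇓pair (⇓pair (⇓fst (⇓snd ⇓v ≈-refl) eY) (⇓fst (⇓snd (⇓snd ⇓v ≈-refl) eY) et)) (⇓snd (⇓snd (⇓snd ⇓v ≈-refl) eY) et) ,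
      (w , k , eW , pair x y , t , vp' , ≈-refl , sol-QR′ , unAp (Ap-≈-result (mkAp {k} {pair x y} (proj₁ (proj₂ (hk (pair x y) sol-QR′)))) inner-agrees) , st)
      where
      eu = proj₁ (pair-inj e)
      eK = proj₂ (pair-inj e)
      sxu : Sol R u x
      sxu = xr u' u x x (≈-sym eu) ≈-refl sx
      cont-agrees : pair (mid x sxu) (inner x) ≈ pair q1' K3
      cont-agrees = ≈-trans (Ap-cong (cont-app x sxu) (mkAp aK) eK ≈-refl) e2
      e1 = proj₁ (pair-inj cont-agrees)
      e3 = proj₂ (pair-inj cont-agrees)
      sol-QR′ : Sol (Q ⋆P R) w (pair x y)
      sol-QR′ = sol-QR x sxu y q1' e1 sy
      inner-agrees : proj₁ (hk (pair x y) sol-QR′) ≈ vp'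
      inner-agrees = Ap-cong (lam-app innerT (x ∷ W ∷ []) y _ (⇓app (⇓snd ⇓v eW) (⇓pair ⇓v ⇓v) (mkAp (proj₁ (proj₂ (hk (pair x y) sol-QR′)))))) (mkAp aK3) e3 ≈-refl

-- ⟨u, k⟩ ↦ ⟨⟨u, λ x. fst (k x)⟩, λ p. snd (k (fst p)) (snd p)⟩
⋆P-assoc : ∀ {P Q R} → SolExt Q → SolExt R → ((P ⋆P Q) ⋆P R) ≤W (P ⋆P (Q ⋆P R))
⋆P-assoc {P} {Q} {R} xq xr = ≤W-fromTerms fwd bwd reduce
  where
  firstT secondT : Tm 2
  firstT = fstT (sndT x1 · x0)
  secondT = sndT (sndT x1 · fstT x0) · sndT x0
  fwd bwd : Tm 1
  fwd = pairT (pairT (fstT x0) (lam firstT)) (lam secondT)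
  bwd = pairT (fstT (fstT (sndT x0))) (pairT (sndT (fstT (sndT x0))) (sndT (sndT x0)))
  reduce : ReducesVia ((P ⋆P Q) ⋆P R) (P ⋆P (Q ⋆P R)) fwd bwd
  reduce W (u , k , eW , du , hk) = v , ⇓fwd , dom , back
    where
    first = lamValue firstT (W ∷ [])
    second = lamValue secondT (W ∷ [])
    v = pair (pair u first) second
    ⇓fwd : (W ∷ []) ⊢ fwd ⇓ v
    ⇓fwd = ⇓pair (⇓pair (⇓fst ⇓v eW) (lam⇓ firstT (W ∷ []))) (lam⇓ secondT (W ∷ []))
    inst = λ x (sx : Sol R u x) → proj₁ (hk x sx)
    k-app = λ x (sx : Sol R u x) → mkAp {k} {x} (proj₁ (proj₂ (hk x sx)))
    inst-dom = λ x (sx : Sol R u x) → proj₂ (proj₂ (hk x sx))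
    mid = λ x sx → proj₁ (inst-dom x sx)
    midCont = λ x sx → proj₁ (proj₂ (inst-dom x sx))
    inst≈ = λ x sx → proj₁ (proj₂ (proj₂ (inst-dom x sx)))
    mid-dom = λ x sx → proj₁ (proj₂ (proj₂ (proj₂ (inst-dom x sx))))
    midCont-ok = λ x sx → proj₂ (proj₂ (proj₂ (proj₂ (inst-dom x sx))))
    first-app : ∀ x (sx : Sol R u x) → Ap first x (mid x sx)
    first-app x sx = lam-app firstT (W ∷ []) x _ (⇓fst (⇓app (⇓snd ⇓v eW) ⇓v (k-app x sx)) (inst≈ x sx))
    second-app : ∀ x (sx : Sol R u x) y p → p ≈ pair x y → (sy : Sol Q (mid x sx) y) → Ap second p (proj₁ (midCont-ok x sx y sy))
    second-app x sx y p ep sy = lam-app secondT (W ∷ []) p _ (⇓app (⇓snd (⇓app (⇓snd ⇓v eW) (⇓fst ⇓v ep) (k-app x sx)) (inst≈ x sx)) (⇓snd ⇓v ep)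
                           (mkAp {midCont x sx} {y} (proj₁ (proj₂ (midCont-ok x sx y sy)))))
    split : ∀ p → Sol (Q ⋆P R) (pair u first) p → Σ Baire λ x → Σ (Sol R u x) λ sx → Σ Baire λ y → (p ≈ pair x y) × Sol Q (mid x sx) y
    split p (u' , K1' , e , x , y , q1' , ep , sx , aK1 , sy) =
      let sxu = xr u' u x x (≈-sym (proj₁ (pair-inj e))) ≈-refl sx in
      x , sxu , y , ep , xq q1' (mid x sxu) y y (Ap-cong (mkAp {K1'} {x} aK1) (first-app x sxu) (≈-sym (proj₂ (pair-inj e))) ≈-refl) ≈-refl sy
    dom : Dom (P ⋆P (Q ⋆P R)) v
    dom = pair u first , second , ≈-refl , (u , first , ≈-refl , du , λ x sx → mid x sx , unAp (first-app x sx) , mid-dom x sx) ,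
      λ p sp → let (x , sx , y , ep , sy) = split p sp in
        _ , unAp (second-app x sx y p ep sy) , proj₂ (proj₂ (midCont-ok x sx y sy))
    back : Answers ((P ⋆P Q) ⋆P R) (P ⋆P (Q ⋆P R)) bwd W v
    back Y (w' , K2' , e , p , t , vp , eY , sp , aK2 , st) =
      let (x , sx , y , ep , sy) = split p (sol⋆P-≈ {Q} {R} (≈-sym (proj₁ (pair-inj e))) sp) in
      let evp = Ap-cong (second-app x sx y p ep sy) (mkAp {K2'} {p} aK2) (proj₂ (pair-inj e)) ≈-refl in
      pair x (pair y t) ,
      ⇓pair (⇓fst (⇓fst (⇓snd ⇓v ≈-refl) eY) ep) (⇓pair (⇓snd (⇓fst (⇓snd ⇓v ≈-refl) eY) ep) (⇓snd (⇓snd ⇓v ≈-refl) eY)) ,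
      (u , k , eW , x , pair y t , inst x sx , ≈-refl , sx , unAp (k-app x sx) ,
        (mid x sx , midCont x sx , inst≈ x sx , y , t , vp , ≈-refl , sy , unAp (Ap-≈-result (mkAp {midCont x sx} {y} (proj₁ (proj₂ (midCont-ok x sx y sy)))) evp) , st))

-- With reductions (φ, ψ) of P to P′ and (φ′, ψ′) of Q to Q′:
-- ⟨u, k⟩ ↦ ⟨φ′ u, λ x′. φ (k (ψ′ ⟨u, x′⟩))⟩
⋆P-mono : ∀ {P P' Q Q'} → SolExt P' → SolExt Q' → P ≤W P' → Q ≤W Q' → (P ⋆P Q) ≤W (P' ⋆P Q')
⋆P-mono {P} {P'} {Q} {Q'} xp' xq' ra rb = ≤W-fromTerms fwd bwd reduce
  where
  contT : Tm 2
  contT = forwardT ra · (sndT x1 · (backwardT rb · pairT (fstT x1) x0))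
  solQ′T : Tm 1
  solQ′T = backwardT rb · pairT (fstT (fstT x0)) (fstT (sndT x0))
  fwd bwd : Tm 1
  fwd = pairT (forwardT rb · fstT x0) (lam contT)
  bwd = pairT solQ′T (backwardT ra · pairT (sndT (fstT x0) · solQ′T) (sndT (sndT x0)))
  reduce : ReducesVia (P ⋆P Q) (P' ⋆P Q') fwd bwd
  reduce W (u , k , e , du , hk) = v , ⇓fwd , dom , back
    where
    forwardQ = ≤W-apply rb u du
    u′ = proj₁ forwardQ
    φQ-app = proj₁ (proj₂ forwardQ)
    du′ = proj₁ (proj₂ (proj₂ forwardQ))
    ψQ = proj₂ (proj₂ (proj₂ forwardQ))
    cont = lamValue contT (W ∷ [])
    v = pair u′ cont
    ⇓fwd : (W ∷ []) ⊢ fwd ⇓ v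
    ⇓fwd = ⇓pair (⇓app ⇓c (⇓fst ⇓v e) φQ-app) (lam⇓ contT (W ∷ []))
    solQ = λ x' (sx' : Sol Q' u′ x') → proj₁ (ψQ x' sx')
    ψQ-app = λ x' (sx' : Sol Q' u′ x') → proj₁ (proj₂ (ψQ x' sx'))
    solQ-ok = λ x' (sx' : Sol Q' u′ x') → proj₂ (proj₂ (ψQ x' sx'))
    hk′ = λ x' (sx' : Sol Q' u′ x') → hk (solQ x' sx') (solQ-ok x' sx')
    instP = λ x' sx' → proj₁ (hk′ x' sx')
    k-app = λ x' sx' → mkAp {k} {solQ x' sx'} (proj₁ (proj₂ (hk′ x' sx')))
    forwardP = λ x' sx' → ≤W-apply ra (instP x' sx') (proj₂ (proj₂ (hk′ x' sx')))
    cont-app : ∀ x' (sx' : Sol Q' u′ x') → Ap cont x' (proj₁ (forwardP x' sx'))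
    cont-app x' sx' = lam-app contT (W ∷ []) x' _ (⇓app ⇓c (⇓app (⇓snd ⇓v e) (⇓app ⇓c (⇓pair (⇓fst ⇓v e) ⇓v) (ψQ-app x' sx')) (k-app x' sx'))
                                          (proj₁ (proj₂ (forwardP x' sx'))))
    dom : Dom (P' ⋆P Q') v
    dom = u′ , cont , ≈-refl , du′ , λ x' sx' → _ , unAp (cont-app x' sx') , proj₁ (proj₂ (proj₂ (forwardP x' sx')))
    back : Answers (P ⋆P Q) (P' ⋆P Q') bwd W v
    back Y (u'' , K' , eV , x' , y' , vx'' , eY , sx'' , aK' , sy') =
      let sx' = xq' u'' u′ x' x' (≈-sym (proj₁ (pair-inj eV))) ≈-refl sx'' in
      let evx = Ap-cong (mkAp {K'} {x'} aK') (cont-app x' sx') (≈-sym (proj₂ (pair-inj eV))) ≈-refl in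
      let (y , ada , sy) = proj₂ (proj₂ (proj₂ (forwardP x' sx'))) y' (xp' vx'' _ y' y' evx ≈-refl sy') in
      let evX = ⇓app ⇓c (⇓pair (⇓fst (⇓fst ⇓v ≈-refl) e) (⇓fst (⇓snd ⇓v ≈-refl) eY)) (ψQ-app x' sx') in
      pair (solQ x' sx') y ,
      ⇓pair evX (⇓app ⇓c (⇓pair (⇓app (⇓snd (⇓fst ⇓v ≈-refl) e) evX (k-app x' sx')) (⇓snd (⇓snd ⇓v ≈-refl) eY)) ada) ,
      (u , k , e , solQ x' sx' , y , instP x' sx' , ≈-refl , solQ-ok x' sx' , unAp (k-app x' sx') , sy)

⋆P-distribˡ-⊔P : ∀ {P Q R} → (P ⋆P (Q ⊔P R)) ≤W ((P ⋆P Q) ⊔P (P ⋆P R))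
⋆P-distribˡ-⊔P {P} {Q} {R} = ≤W-fromTerms fwd (sndT x0) reduce
  where
  inlT inrT : Tm 2
  inlT = in1T (pairT (tailT (fstT x0)) (sndT x0))
  inrT = in2T (pairT (tailT (fstT x0)) (sndT x0))
  fwd : Tm 1
  fwd = caseT (fstT x0) (lam inlT) (lam inrT) x0
  reduce : ReducesVia (P ⋆P (Q ⊔P R)) ((P ⋆P Q) ⊔P (P ⋆P R)) fwd (sndT x0)
  reduce W (w , k , e , inj₁ (u , ew , du) , hk) =
    in₁ (pair u k) ,
    ⇓case-zero (⇓fst ⇓v e) (ew 0) (lam⇓ inlT (W ∷ [])) (lam⇓ inrT (W ∷ [])) ⇓v
      (lam-app inlT (W ∷ []) W _ (⇓in₁ (⇓pair (⇓tail (⇓fst ⇓v e) ew) (⇓snd ⇓v e)))) ,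
    inj₁ (pair u k , ≈-refl , (u , k , ≈-refl , du , λ x sx → hk x (inj₁ (u , ew , sx)))) ,
    λ { y (inj₂ (p , ep , _)) → ⊥-elim (in₁≉in₂ ep)
      ; y (inj₁ (p , ep , (u' , k' , epp , x , y' , vv , ez , sx , ak , sy))) →
        let ee = pair-inj (≈-trans (proj₂ (cons-inj ep)) epp) in
        y , ⇓snd ⇓v ≈-refl , (w , k' , ≈-trans e (pair-cong ≈-refl (proj₂ ee)) , x , y' , vv , ez , inj₁ (u' , ≈-trans ew (cons-cong (proj₁ ee)) , sx) , ak , sy) }
  reduce W (w , k , e , inj₂ (u , ew , du) , hk) =
    in₂ (pair u k) ,
    ⇓case-suc (⇓fst ⇓v e) (ew 0) (lam⇓ inlT (W ∷ [])) (lam⇓ inrT (W ∷ [])) ⇓v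
      (lam-app inrT (W ∷ []) W _ (⇓in₂ (⇓pair (⇓tail (⇓fst ⇓v e) ew) (⇓snd ⇓v e)))) ,
    inj₂ (pair u k , ≈-refl , (u , k , ≈-refl , du , λ x sx → hk x (inj₂ (u , ew , sx)))) ,
    λ { y (inj₁ (p , ep , _)) → ⊥-elim (in₁≉in₂ (≈-sym ep))
      ; y (inj₂ (p , ep , (u' , k' , epp , x , y' , vv , ez , sx , ak , sy))) →
        let ee = pair-inj (≈-trans (proj₂ (cons-inj ep)) epp) in
        y , ⇓snd ⇓v ≈-refl , (w , k' , ≈-trans e (pair-cong ≈-refl (proj₂ ee)) , x , y' , vv , ez , inj₂ (u' , ≈-trans ew (cons-cong (proj₁ ee)) , sx) , ak , sy) }

-- ⟨⟨u₁, k₁⟩, ⟨u₂, k₂⟩⟩ ↦ ⟨⟨u₁, u₂⟩, λ x. k₁ x₁ if x = in₁ x₁, k₂ x₂ if x = in₂ x₂⟩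
⋆P-distribˡ-⊓P : ∀ {P Q R} → SolExt Q → SolExt R → ((P ⋆P Q) ⊓P (P ⋆P R)) ≤W (P ⋆P (Q ⊓P R))
⋆P-distribˡ-⊓P {P} {Q} {R} xq xr = ≤W-fromTerms fwd bwd reduce
  where
  branch₁T branch₂T : Tm 3
  branch₁T = sndT (fstT x2) · tailT x0
  branch₂T = sndT (sndT x2) · tailT x0
  contT : Tm 2
  contT = caseT x0 (lam branch₁T) (lam branch₂T) x0
  back₁T back₂T : Tm 2
  back₁T = in1T (pairT (tailT (fstT (sndT x0))) (sndT (sndT x0)))
  back₂T = in2T (pairT (tailT (fstT (sndT x0))) (sndT (sndT x0)))
  fwd bwd : Tm 1
  fwd = pairT (pairT (fstT (fstT x0)) (fstT (sndT x0))) (lam contT)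
  bwd = caseT (fstT (sndT x0)) (lam back₁T) (lam back₂T) x0
  reduce : ReducesVia ((P ⋆P Q) ⊓P (P ⋆P R)) (P ⋆P (Q ⊓P R)) fwd bwd
  reduce W (w1 , w2 , e , (u1 , k1 , e1 , du1 , hk1) , (u2 , k2 , e2 , du2 , hk2)) = v , ⇓fwd , dom , back
    where
    cont = lamValue contT (W ∷ [])
    v = pair (pair u1 u2) cont
    ⇓fwd : (W ∷ []) ⊢ fwd ⇓ v
    ⇓fwd = ⇓pair (⇓pair (⇓fst (⇓fst ⇓v e) e1) (⇓fst (⇓snd ⇓v e) e2)) (lam⇓ contT (W ∷ []))
    Branch : Baire → Baire → Set
    Branch x vv = (Σ Baire λ x1 → (x ≈ in₁ x1) × Sol Q u1 x1 × App k1 x1 vv) ⊎ (Σ Baire λ x2 → (x ≈ in₂ x2) × Sol R u2 x2 × App k2 x2 vv)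
    cont-app : ∀ x → Sol (Q ⊓P R) (pair u1 u2) x → Σ Baire λ vv → Ap cont x vv × Dom P vv × Branch x vv
    cont-app x (u1' , u2' , ex , inj₁ (x1 , ex₁ , sx1)) =
      let sx1u = xq u1' u1 x1 x1 (≈-sym (proj₁ (pair-inj ex))) ≈-refl sx1 in
      let (vv , a , dv) = hk1 x1 sx1u in
      vv , lam-app contT (W ∷ []) x vv (⇓case-zero ⇓v (ex₁ 0) (lam⇓ branch₁T (x ∷ W ∷ [])) (lam⇓ branch₂T (x ∷ W ∷ [])) ⇓v
             (lam-app branch₁T (x ∷ W ∷ []) x vv (⇓app (⇓snd (⇓fst ⇓v e) e1) (⇓tail ⇓v ex₁) (mkAp {k1} {x1} a)))) ,
      dv , inj₁ (x1 , ex₁ , sx1u , a)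
    cont-app x (u1' , u2' , ex , inj₂ (x2 , ex₂ , sx2)) =
      let sx2u = xr u2' u2 x2 x2 (≈-sym (proj₂ (pair-inj ex))) ≈-refl sx2 in
      let (vv , a , dv) = hk2 x2 sx2u in
      vv , lam-app contT (W ∷ []) x vv (⇓case-suc ⇓v (ex₂ 0) (lam⇓ branch₁T (x ∷ W ∷ [])) (lam⇓ branch₂T (x ∷ W ∷ [])) ⇓v
             (lam-app branch₂T (x ∷ W ∷ []) x vv (⇓app (⇓snd (⇓snd ⇓v e) e2) (⇓tail ⇓v ex₂) (mkAp {k2} {x2} a)))) ,
      dv , inj₂ (x2 , ex₂ , sx2u , a)
    dom : Dom (P ⋆P (Q ⊓P R)) v
    dom = pair u1 u2 , cont , ≈-refl , (u1 , u2 , ≈-refl , du1 , du2) , λ x sx → let (vv , a , dv , _) = cont-app x sx in vv , unAp a , dv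
    back : Answers ((P ⋆P Q) ⊓P (P ⋆P R)) (P ⋆P (Q ⊓P R)) bwd W v
    back Y (u' , K' , eV , x , y , vv' , eY , sx , aK' , sy) = answer (proj₂ (proj₂ (proj₂ chosen)))
      where
      chosen = cont-app x (sol⊓P-≈ {Q} {R} (≈-sym (proj₁ (pair-inj eV))) sx)
      cont-agrees : vv' ≈ proj₁ chosen
      cont-agrees = Ap-cong (mkAp {K'} {x} aK') (proj₁ (proj₂ chosen)) (≈-sym (proj₂ (pair-inj eV))) ≈-refl
      answer : Branch x (proj₁ chosen) → Σ Baire λ z → ((pair W Y ∷ []) ⊢ bwd ⇓ z) × Sol ((P ⋆P Q) ⊓P (P ⋆P R)) W z
      answer (inj₁ (x1 , ex₁ , sx1 , ak1)) = in₁ (pair x1 y) ,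
        ⇓case-zero (⇓fst (⇓snd ⇓v ≈-refl) eY) (ex₁ 0) (lam⇓ back₁T (pair W Y ∷ [])) (lam⇓ back₂T (pair W Y ∷ [])) ⇓v
          (lam-app back₁T (pair W Y ∷ []) (pair W Y) _ (⇓in₁ (⇓pair (⇓tail (⇓fst (⇓snd ⇓v ≈-refl) eY) ex₁) (⇓snd (⇓snd ⇓v ≈-refl) eY)))) ,
        (w1 , w2 , e , inj₁ (pair x1 y , ≈-refl , (u1 , k1 , e1 , x1 , y , vv' , ≈-refl , sx1 , unAp (Ap-≈-result (mkAp {k1} {x1} ak1) (≈-sym cont-agrees)) , sy)))
      answer (inj₂ (x2 , ex₂ , sx2 , ak2)) = in₂ (pair x2 y) ,
        ⇓case-suc (⇓fst (⇓snd ⇓v ≈-refl) eY) (ex₂ 0) (lam⇓ back₁T (pair W Y ∷ [])) (lam⇓ back₂T (pair W Y ∷ [])) ⇓v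
          (lam-app back₂T (pair W Y ∷ []) (pair W Y) _ (⇓in₂ (⇓pair (⇓tail (⇓fst (⇓snd ⇓v ≈-refl) eY) ex₂) (⇓snd (⇓snd ⇓v ≈-refl) eY)))) ,
        (w1 , w2 , e , inj₂ (pair x2 y , ≈-refl , (u2 , k2 , e2 , x2 , y , vv' , ≈-refl , sx2 , unAp (Ap-≈-result (mkAp {k2} {x2} ak2) (≈-sym cont-agrees)) , sy)))

-- ⟨⟨u, k⟩, w⟩ ↦ ⟨u, λ x. ⟨k x, w⟩⟩
⋆P-⊓P-exchange : ∀ {P Q R} → SolExt Q → ((P ⋆P Q) ⊓P R) ≤W ((P ⊓P R) ⋆P Q)
⋆P-⊓P-exchange {P} {Q} {R} xq = ≤W-fromTerms fwd bwd reduce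
  where
  contT : Tm 2
  contT = pairT (sndT (fstT x1) · x0) (sndT x1)
  fromP′T fromRT : Tm 2
  fromP′T = in1T (pairT (fstT (sndT x0)) (tailT (sndT (sndT x0))))
  fromRT = sndT (sndT x0)
  fwd bwd : Tm 1
  fwd = pairT (fstT (fstT x0)) (lam contT)
  bwd = caseT (sndT (sndT x0)) (lam fromP′T) (lam fromRT) x0
  reduce : ReducesVia ((P ⋆P Q) ⊓P R) ((P ⊓P R) ⋆P Q) fwd bwd
  reduce W (w1 , w2 , e , (u , k , e1 , du , hk) , d2) = v , ⇓fwd , dom , back
    where
    cont = lamValue contT (W ∷ [])
    v = pair u cont
    ⇓fwd : (W ∷ []) ⊢ fwd ⇓ v
    ⇓fwd = ⇓pair (⇓fst (⇓fst ⇓v e) e1) (lam⇓ contT (W ∷ []))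
    k-app = λ x (sx : Sol Q u x) → mkAp {k} {x} (proj₁ (proj₂ (hk x sx)))
    cont-app : ∀ x (sx : Sol Q u x) → Ap cont x (pair (proj₁ (hk x sx)) w2)
    cont-app x sx = lam-app contT (W ∷ []) x _ (⇓pair (⇓app (⇓snd (⇓fst ⇓v e) e1) ⇓v (k-app x sx)) (⇓snd ⇓v e))
    dom : Dom ((P ⊓P R) ⋆P Q) v
    dom = u , cont , ≈-refl , du , λ x sx → _ , unAp (cont-app x sx) , (proj₁ (hk x sx) , w2 , ≈-refl , proj₂ (proj₂ (hk x sx)) , d2)
    back : Answers ((P ⋆P Q) ⊓P R) ((P ⊓P R) ⋆P Q) bwd W v
    back Y (u' , K' , eV , x , r , vv , eY , sx , aK' , (a1 , a2 , evv , sr)) = answer sr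
      where
      sxu = xq u' u x x (≈-sym (proj₁ (pair-inj eV))) ≈-refl sx
      ep : pair (proj₁ (hk x sxu)) w2 ≈ pair a1 a2
      ep = ≈-trans (Ap-cong (cont-app x sxu) (mkAp {K'} {x} aK') (proj₂ (pair-inj eV)) ≈-refl) evv
      answer : (Σ Baire λ y → (r ≈ in₁ y) × Sol P a1 y) ⊎ (Σ Baire λ y → (r ≈ in₂ y) × Sol R a2 y) →
            Σ Baire λ z → ((pair W Y ∷ []) ⊢ bwd ⇓ z) × Sol ((P ⋆P Q) ⊓P R) W z
      answer (inj₁ (y , er , sy)) = in₁ (pair x y) ,
        ⇓case-zero (⇓snd (⇓snd ⇓v ≈-refl) eY) (er 0) (lam⇓ fromP′T (pair W Y ∷ [])) (lam⇓ fromRT (pair W Y ∷ [])) ⇓v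
          (lam-app fromP′T (pair W Y ∷ []) (pair W Y) _ (⇓in₁ (⇓pair (⇓fst (⇓snd ⇓v ≈-refl) eY) (⇓tail (⇓snd (⇓snd ⇓v ≈-refl) eY) er)))) ,
        (w1 , w2 , e , inj₁ (pair x y , ≈-refl , (u , k , e1 , x , y , a1 , ≈-refl , sxu , unAp (Ap-≈-result (k-app x sxu) (proj₁ (pair-inj ep))) , sy)))
      answer (inj₂ (y , er , sy)) = r ,
        ⇓case-suc (⇓snd (⇓snd ⇓v ≈-refl) eY) (er 0) (lam⇓ fromP′T (pair W Y ∷ [])) (lam⇓ fromRT (pair W Y ∷ [])) ⇓v
          (lam-app fromRT (pair W Y ∷ []) (pair W Y) _ (⇓snd (⇓snd ⇓v ≈-refl) eY)) ,
        (w1 , a2 , ≈-trans e (pair-cong ≈-refl (proj₂ (pair-inj ep))) , inj₂ (y , er , sy))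

-- With (φ, ψ) the given reduction, Φ acts on instances ⟨u, ⟨t, k⟩⟩ by
--   Φ ⟨u, ⟨•, k⟩⟩ = k •   and   Φ ⟨u, ⟨⟨s, m⟩, k⟩⟩ = φ ⟨u, ⟨s, λ x. Φ ⟨u, ⟨m x, λ z. k ⟨x, z⟩⟩⟩⟩⟩,
-- and Ψ undoes this on solutions; both are correct by induction on the tree t.
module ◇P-Induction {P Q R : Problem} (xq : SolExt Q) (xr : SolExt R) (rr : (P ⊓P (Q ⋆P R)) ≤W Q) where

  curryBody : Tm 3
  curryBody = x2 · pairT x1 x0
  curryC : Constant
  curryC = lamValue (lam (lam curryBody)) [] , lam-computable (lam (lam curryBody)) [] allComputable-[]
  curried : Baire → Baire → Baire
  curried k x = lamValue curryBody (x ∷ k ∷ [])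
  ⇓curried : ∀ {n} {E : Vec Baire n} {A B k x} → E ⊢ A ⇓ k → E ⊢ B ⇓ x → E ⊢ cst curryC · A · B ⇓ curried k x
  ⇓curried {k = k} {x} ha hb = ⇓app (⇓app ⇓c ha (lam-app (lam (lam curryBody)) [] k _ (lam⇓ (lam curryBody) (k ∷ [])))) hb
                                 (lam-app (lam curryBody) (k ∷ []) x _ (lam⇓ curryBody (x ∷ k ∷ [])))
  curried-app : ∀ {k x z r} → Ap k (pair x z) r → Ap (curried k x) z r
  curried-app {k} {x} {z} {r} a = lam-app curryBody (x ∷ k ∷ []) z r (⇓app ⇓v (⇓pair ⇓v ⇓v) a)

  descendBody : Tm 5
  descendBody = x4 · pairT x3 (pairT (x2 · x0) (cst curryC · x1 · x0))
  descendC : Constant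
  descendC = lamValue (lam (lam (lam (lam descendBody)))) [] , lam-computable (lam (lam (lam (lam descendBody)))) [] allComputable-[]
  descend : Baire → Baire → Baire → Baire → Baire
  descend g u m k = lamValue descendBody (k ∷ m ∷ u ∷ g ∷ [])
  ⇓descend : ∀ {n} {E : Vec Baire n} {G U M Kk g u m k} → E ⊢ G ⇓ g → E ⊢ U ⇓ u → E ⊢ M ⇓ m → E ⊢ Kk ⇓ k →
             E ⊢ cst descendC · G · U · M · Kk ⇓ descend g u m k
  ⇓descend {g = g} {u} {m} {k} hg hu hm hk =
    ⇓app (⇓app (⇓app (⇓app ⇓c hg (lam-app (lam (lam (lam (lam descendBody)))) [] g _ (lam⇓ (lam (lam (lam descendBody))) (g ∷ []))))
       hu (lam-app (lam (lam (lam descendBody))) (g ∷ []) u _ (lam⇓ (lam (lam descendBody)) (u ∷ g ∷ []))))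
       hm (lam-app (lam (lam descendBody)) (u ∷ g ∷ []) m _ (lam⇓ (lam descendBody) (m ∷ u ∷ g ∷ []))))
       hk (lam-app (lam descendBody) (m ∷ u ∷ g ∷ []) k _ (lam⇓ descendBody (k ∷ m ∷ u ∷ g ∷ [])))
  descend-app : ∀ {g u m k x v' r} → Ap g (pair u (pair v' (curried k x))) r → Ap m x v' → Ap (descend g u m k) x r
  descend-app {g} {u} {m} {k} {x} ag am =
    lam-app descendBody (k ∷ m ∷ u ∷ g ∷ []) x _ (⇓app ⇓v (⇓pair ⇓v (⇓pair (⇓app ⇓v ⇓v am) (⇓curried ⇓v ⇓v))) ag)

  Φ-leaf Φ-node : Tm 3
  Φ-leaf = sndT (sndT x0) · bulletT
  Φ-node = forwardT rr · pairT (fstT x0) (pairT (fstT (fstT (sndT x0))) (cst descendC · x2 · fstT x0 · sndT (fstT (sndT x0)) · sndT (sndT x0)))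
  Φ-body : Tm 2
  Φ-body = caseT (fstT (sndT x0)) (lam Φ-leaf) (lam Φ-node) x0

  Φ : Baire
  Φ = proj₁ (fixpoint Φ-body)
  Φ-computable : Computable Φ
  Φ-computable = proj₁ (proj₂ (fixpoint Φ-body))
  Φ-unfold : ∀ w y → (w ∷ Φ ∷ []) ⊢ Φ-body ⇓ y → Ap Φ w y
  Φ-unfold = proj₂ (proj₂ (fixpoint Φ-body))

  uT3 tT3 kT3 : Tm 3
  uT3 = fstT (fstT x0)
  tT3 = fstT (sndT (fstT x0))
  kT3 = sndT (sndT (fstT x0))
  uT4 tT4 kT4 qT : Tm 4
  uT4 = fstT (fstT x1)
  tT4 = fstT (sndT (fstT x1))
  kT4 = sndT (sndT (fstT x1))
  qT = tailT x0
  Ψ-leaf ψ-answer : Tm 3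
  Ψ-leaf = in2T (pairT bulletT (sndT x0))
  ψ-answer = backwardT rr · pairT (pairT uT3 (pairT (fstT tT3) (cst descendC · cst (Φ , Φ-computable) · uT3 · sndT tT3 · kT3))) (sndT x0)
  Ψ-child : Tm 4
  Ψ-child = x3 · pairT (pairT uT4 (pairT (sndT tT4 · fstT qT) (cst curryC · kT4 · fstT qT))) (sndT qT)
  Ψ-extend : Tm 5
  Ψ-extend = in2T (pairT (pairT (fstT (tailT x1)) (fstT (tailT x0))) (sndT (tailT x0)))
  Ψ-recurse : Tm 4
  Ψ-recurse = caseT Ψ-child (lam x0) (lam Ψ-extend) Ψ-child
  Ψ-node : Tm 3
  Ψ-node = caseT ψ-answer (lam x0) (lam Ψ-recurse) ψ-answer
  Ψ-body : Tm 2
  Ψ-body = caseT (fstT (sndT (fstT x0))) (lam Ψ-leaf) (lam Ψ-node) x0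

  Ψ : Baire
  Ψ = proj₁ (fixpoint Ψ-body)
  Ψ-computable : Computable Ψ
  Ψ-computable = proj₁ (proj₂ (fixpoint Ψ-body))
  Ψ-unfold : ∀ w y → (w ∷ Ψ ∷ []) ⊢ Ψ-body ⇓ y → Ap Ψ w y
  Ψ-unfold = proj₂ (proj₂ (fixpoint Ψ-body))

  Target : Problem
  Target = P ⊓P (Q ⋆P (R ◇P))

  Continues : Baire → Baire → Set
  Continues t k = ∀ x → SolD R t x → Σ Baire λ v → App k x v × Dom Q v

  Realised : Baire → Set
  Realised W = Σ Baire λ v → Ap Φ W v × Dom Q v × (∀ y → Sol Q v y → Σ Baire λ z → Ap Ψ (pair W y) z × Sol Target W z)

  realised-leaf : ∀ {t} → t ≈ bullet → ∀ u k → Continues t k → Realised (pair u (pair t k))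
  realised-leaf {t} eb u k hk =
    let (v , a , dv) = hk bullet (leafS t bullet eb ≈-refl) in
    v , Φ-unfold W v (⇓case-zero (⇓fst (⇓snd ⇓v ≈-refl) ≈-refl) (eb 0) (lam⇓ Φ-leaf (W ∷ Φ ∷ [])) (lam⇓ Φ-node (W ∷ Φ ∷ [])) ⇓v
           (lam-app Φ-leaf (W ∷ Φ ∷ []) W v (⇓app (⇓snd (⇓snd ⇓v ≈-refl) ≈-refl) ⇓c (mkAp {k} {bullet} a)))) , dv ,
    λ y sy → in₂ (pair bullet y) ,
      Ψ-unfold (pair W y) _ (⇓case-zero (⇓fst (⇓snd (⇓fst ⇓v ≈-refl) ≈-refl) ≈-refl) (eb 0)
                              (lam⇓ Ψ-leaf (pair W y ∷ Ψ ∷ [])) (lam⇓ Ψ-node (pair W y ∷ Ψ ∷ [])) ⇓v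
        (lam-app Ψ-leaf (pair W y ∷ Ψ ∷ []) (pair W y) _ (⇓in₂ (⇓pair ⇓c (⇓snd ⇓v ≈-refl))))) ,
      (u , pair t k , ≈-refl , inj₂ (pair bullet y , ≈-refl , (t , k , ≈-refl , bullet , y , v , ≈-refl , leafS t bullet eb ≈-refl , a , sy)))
    where
    W = pair u (pair t k)

  module Node {t s m : Baire} (et : t ≈ pair s m) (hm : ∀ x → Sol R s x → Σ Baire λ v → App m x v × DomD R v)
              (u k : Baire) (hk : Continues t k) where

    child : ∀ x → Sol R s x → Baire
    child x sx = proj₁ (hm x sx)

    m-app : ∀ x (sx : Sol R s x) → Ap m x (child x sx)
    m-app x sx = mkAp (proj₁ (proj₂ (hm x sx)))

    child-sol : ∀ x (sx : Sol R s x) z → SolD R (child x sx) z → SolD R t (pair x z)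
    child-sol x sx z sz = nodeS t (pair x z) s m x (child x sx) z et sx (unAp (m-app x sx)) sz ≈-refl

    child-continues : ∀ x (sx : Sol R s x) → Continues (child x sx) (curried k x)
    child-continues x sx z sz = let (v , a , dv) = hk (pair x z) (child-sol x sx z sz) in v , unAp (curried-app (mkAp {k} {pair x z} a)) , dv

    module _ (du : Dom P u) (ds : Dom R s) (IH : ∀ x (sx : Sol R s x) → Realised (pair u (pair (child x sx) (curried k x)))) where

      W : Baire
      W = pair u (pair t k)
      K : Baire
      K = descend Φ u m k

      K-app : ∀ x (sx : Sol R s x) → Ap K x (proj₁ (IH x sx))
      K-app x sx = descend-app {Φ} {u} {m} {k} {x} (proj₁ (proj₂ (IH x sx))) (m-app x sx)

      instance⊓ : Dom (P ⊓P (Q ⋆P R)) (pair u (pair s K))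
      instance⊓ = u , pair s K , ≈-refl , du , (s , K , ≈-refl , ds , λ x sx → proj₁ (IH x sx) , unAp (K-app x sx) , proj₁ (proj₂ (proj₂ (IH x sx))))

      v : Baire
      v = proj₁ (≤W-apply rr (pair u (pair s K)) instance⊓)
      φ-app : Ap (proj₁ rr) (pair u (pair s K)) v
      φ-app = proj₁ (proj₂ (≤W-apply rr (pair u (pair s K)) instance⊓))
      ψ-back : ∀ y → Sol Q v y → Σ Baire λ z → Ap (proj₁ (proj₂ rr)) (pair (pair u (pair s K)) y) z × Sol (P ⊓P (Q ⋆P R)) (pair u (pair s K)) z
      ψ-back = proj₂ (proj₂ (proj₂ (≤W-apply rr (pair u (pair s K)) instance⊓)))

      Φ-app : Ap Φ W v
      Φ-app = Φ-unfold W v (⇓case-suc (⇓fst (⇓snd ⇓v ≈-refl) ≈-refl) (et 0) (lam⇓ Φ-leaf (W ∷ Φ ∷ [])) (lam⇓ Φ-node (W ∷ Φ ∷ [])) ⇓v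
        (lam-app Φ-node (W ∷ Φ ∷ []) W v
          (⇓app ⇓c (⇓pair (⇓fst ⇓v ≈-refl) (⇓pair (⇓fst (⇓fst (⇓snd ⇓v ≈-refl) ≈-refl) et)
             (⇓descend ⇓v (⇓fst ⇓v ≈-refl) (⇓snd (⇓fst (⇓snd ⇓v ≈-refl) ≈-refl) et) (⇓snd (⇓snd ⇓v ≈-refl) ≈-refl)))) φ-app)))

      module Back (y : Baire) where
        E2 : Vec Baire 2
        E2 = pair W y ∷ Ψ ∷ []
        E3 : Vec Baire 3
        E3 = pair W y ∷ E2

        ⇓u : E3 ⊢ uT3 ⇓ u
        ⇓u = ⇓fst (⇓fst ⇓v ≈-refl) ≈-refl
        ⇓t : E3 ⊢ tT3 ⇓ t
        ⇓t = ⇓fst (⇓snd (⇓fst ⇓v ≈-refl) ≈-refl) ≈-refl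
        ⇓k : E3 ⊢ kT3 ⇓ k
        ⇓k = ⇓snd (⇓snd (⇓fst ⇓v ≈-refl) ≈-refl) ≈-refl

        ⇓ψ-answer : ∀ {r} → Ap (proj₁ (proj₂ rr)) (pair (pair u (pair s K)) y) r → E3 ⊢ ψ-answer ⇓ r
        ⇓ψ-answer aψ = ⇓app ⇓c (⇓pair (⇓pair ⇓u (⇓pair (⇓fst ⇓t et) (⇓descend ⇓c ⇓u (⇓snd ⇓t et) ⇓k))) (⇓snd ⇓v ≈-refl)) aψ

        Ψ-app : ∀ {z} → E3 ⊢ Ψ-node ⇓ z → Ap Ψ (pair W y) z
        Ψ-app hN = Ψ-unfold (pair W y) _ (⇓case-suc (⇓fst (⇓snd (⇓fst ⇓v ≈-refl) ≈-refl) ≈-refl) (et 0) (lam⇓ Ψ-leaf E2) (lam⇓ Ψ-node E2) ⇓v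
                     (lam-app Ψ-node E2 (pair W y) _ hN))

        fromP : ∀ r → Ap (proj₁ (proj₂ rr)) (pair (pair u (pair s K)) y) r → ∀ {u₁} → u ≈ u₁ → ∀ x → r ≈ in₁ x → Sol P u₁ x →
                Σ Baire λ z → Ap Ψ (pair W y) z × Sol Target W z
        fromP r aψ eu x er sx =
          r , Ψ-app (⇓case-zero (⇓ψ-answer aψ) (er 0) (lam⇓ x0 E3) (lam⇓ Ψ-recurse E3) (⇓ψ-answer aψ) (lam-app x0 E3 r r ⇓v)) ,
          (_ , pair t k , pair-cong eu ≈-refl , inj₁ (x , er , sx))

        fromQR : ∀ r → Ap (proj₁ (proj₂ rr)) (pair (pair u (pair s K)) y) r → ∀ q → r ≈ in₂ q → Sol (Q ⋆P R) (pair s K) q →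
                 Σ Baire λ z → Ap Ψ (pair W y) z × Sol Target W z
        fromQR r aψ q er (s' , K' , eK , x , y' , v' , eq , sx' , aK' , sy') = extend (proj₂ (proj₂ child-back))
          where
          esK = pair-inj eK
          sx = xr s' s x x (≈-sym (proj₁ esK)) ≈-refl sx'
          ev' = Ap-cong (mkAp {K'} {x} aK') (K-app x sx) (≈-sym (proj₂ esK)) ≈-refl
          child-back = proj₂ (proj₂ (proj₂ (IH x sx))) y' (xq v' (proj₁ (IH x sx)) y' y' ev' ≈-refl sy')
          z' = proj₁ child-back
          E4 : Vec Baire 4
          E4 = r ∷ E3
          ⇓q : E4 ⊢ qT ⇓ q
          ⇓q = ⇓tail ⇓v er
          ⇓t₄ : E4 ⊢ tT4 ⇓ t
          ⇓t₄ = ⇓fst (⇓snd (⇓fst ⇓v ≈-refl) ≈-refl) ≈-refl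
          ⇓Ψ-child : E4 ⊢ Ψ-child ⇓ z'
          ⇓Ψ-child = ⇓app ⇓v (⇓pair (⇓pair (⇓fst (⇓fst ⇓v ≈-refl) ≈-refl)
                         (⇓pair (⇓app (⇓snd ⇓t₄ et) (⇓fst ⇓q eq) (m-app x sx))
                                (⇓curried (⇓snd (⇓snd (⇓fst ⇓v ≈-refl) ≈-refl) ≈-refl) (⇓fst ⇓q eq)))) (⇓snd ⇓q eq)) (proj₁ (proj₂ child-back))
          recurse : ∀ {z} → E4 ⊢ Ψ-recurse ⇓ z → Ap Ψ (pair W y) z
          recurse hI = Ψ-app (⇓case-suc (⇓ψ-answer aψ) (er 0) (lam⇓ x0 E3) (lam⇓ Ψ-recurse E3) (⇓ψ-answer aψ) (lam-app Ψ-recurse E3 r _ hI))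
          extend : Sol Target (pair u (pair (child x sx) (curried k x))) z' → Σ Baire λ z → Ap Ψ (pair W y) z × Sol Target W z
          extend (u₂ , w₂ , e₂ , inj₁ (x₂ , ez , sx₂)) =
            z' , recurse (⇓case-zero ⇓Ψ-child (ez 0) (lam⇓ x0 E4) (lam⇓ Ψ-extend E4) ⇓Ψ-child (lam-app x0 E4 z' z' ⇓v)) ,
            (u₂ , pair t k , pair-cong (proj₁ (pair-inj e₂)) ≈-refl , inj₁ (x₂ , ez , sx₂))
          extend (u₂ , w₂ , e₂ , inj₂ (p₂ , ez , (t₂ , k₂ , ew₂ , ζ , y'' , v'' , ep₂ , sζ , ak₂ , sy₂))) =
            in₂ (pair (pair x ζ) y'') ,
            recurse (⇓case-suc ⇓Ψ-child (ez 0) (lam⇓ x0 E4) (lam⇓ Ψ-extend E4) ⇓Ψ-child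
              (lam-app Ψ-extend E4 z' _ (⇓in₂ (⇓pair (⇓pair (⇓fst (⇓tail ⇓v er) eq) (⇓fst (⇓tail ⇓v ez) ep₂)) (⇓snd (⇓tail ⇓v ez) ep₂))))) ,
            (u , pair t k , ≈-refl , inj₂ (pair (pair x ζ) y'' , ≈-refl , (t , k , ≈-refl , pair x ζ , y'' , v'' , ≈-refl , sol-t ,
               unAp (Ap-≈-result (mkAp {k} {pair x ζ} (proj₁ (proj₂ cont))) ev'') , sy₂)))
            where
            etk = pair-inj (≈-trans (proj₂ (pair-inj e₂)) ew₂)
            sol-t = child-sol x sx ζ (solD-≈ (≈-sym (proj₁ etk)) sζ)
            cont = hk (pair x ζ) sol-t
            ev'' = Ap-cong (curried-app (mkAp {k} {pair x ζ} (proj₁ (proj₂ cont)))) (mkAp {k₂} {ζ} ak₂) (proj₂ etk) ≈-refl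

        fromψ : (Σ Baire λ r → Ap (proj₁ (proj₂ rr)) (pair (pair u (pair s K)) y) r × Sol (P ⊓P (Q ⋆P R)) (pair u (pair s K)) r) →
                Σ Baire λ z → Ap Ψ (pair W y) z × Sol Target W z
        fromψ (r , aψ , (u₁ , w₁ , e₁ , inj₁ (x , er , sx))) = fromP r aψ (proj₁ (pair-inj e₁)) x er sx
        fromψ (r , aψ , (u₁ , w₁ , e₁ , inj₂ (q , er , sq))) = fromQR r aψ q er (sol⋆P-≈ {Q} {R} (≈-sym (proj₂ (pair-inj e₁))) sq)

      realised : Realised W
      realised = v , Φ-app , proj₁ (proj₂ (proj₂ (≤W-apply rr (pair u (pair s K)) instance⊓))) , λ y sy → Back.fromψ y (ψ-back y sy)

  realised : ∀ {t} → DomD R t → ∀ u k → Dom P u → Continues t k → Realised (pair u (pair t k))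
  realised (leaf t eb) u k du hk = realised-leaf eb u k hk
  realised (node t s m et ds hm) u k du hk =
    Node.realised et hm u k hk du ds (λ x sx → realised (proj₂ (proj₂ (hm x sx))) u (curried k x) du (Node.child-continues et hm u k hk x sx))

◇P-induction : ∀ {P Q R} → SolExt Q → SolExt R → (P ⊓P (Q ⋆P R)) ≤W Q → (P ⊓P (Q ⋆P (R ◇P))) ≤W Q
◇P-induction {P} {Q} {R} xq xr rr = Φ , Ψ , Φ-computable , Ψ-computable ,
  λ { W (u , w , eW , du , (t , k , ew , dt , hk)) →
    let (v , aΦ , dv , back) = realised dt u k du hk in
    let eW' = ≈-trans eW (pair-cong ≈-refl ew) in
    v , unAp (Ap-≈-arg aΦ (≈-sym eW')) , dv ,
    λ y sy → let (z , aΨ , sz) = back y sy in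
      z , unAp (Ap-≈-arg aΨ (pair-cong (≈-sym eW') ≈-refl)) , sol⊓P-≈ {P} {Q ⋆P (R ◇P)} (≈-sym eW') sz }
  where
  open ◇P-Induction xq xr rr

⟦⟧-solExt : ∀ {n} (ρ : Fin n → Problem) → (∀ a → SolExt (ρ a)) → ∀ e → SolExt (⟦ e ⟧ ρ)
⟦⟧-solExt ρ ext (var a) = ext a
⟦⟧-solExt ρ ext 𝟎 u u' x x' eu ex ()
⟦⟧-solExt ρ ext 𝐓 u u' x x' eu ex ()
⟦⟧-solExt ρ ext 𝟏 u u' x x' eu ex s = ≈-trans (≈-sym ex) s
⟦⟧-solExt ρ ext (e ∨ f) w w' z z' ew ez (inj₁ (u , eu , s)) = inj₁ (u , ≈-trans (≈-sym ew) eu , ⟦⟧-solExt ρ ext e u u z z' ≈-refl ez s)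
⟦⟧-solExt ρ ext (e ∨ f) w w' z z' ew ez (inj₂ (u , eu , s)) = inj₂ (u , ≈-trans (≈-sym ew) eu , ⟦⟧-solExt ρ ext f u u z z' ≈-refl ez s)
⟦⟧-solExt ρ ext (e ∧ f) w w' z z' ew ez (u , v , eq , inj₁ (x , ex , s)) = u , v , ≈-trans (≈-sym ew) eq , inj₁ (x , ≈-trans (≈-sym ez) ex , s)
⟦⟧-solExt ρ ext (e ∧ f) w w' z z' ew ez (u , v , eq , inj₂ (x , ex , s)) = u , v , ≈-trans (≈-sym ew) eq , inj₂ (x , ≈-trans (≈-sym ez) ex , s)
⟦⟧-solExt ρ ext (e ⋆ f) w w' z z' ew ez (u , c , eq , x , y , v , exy , rest) = u , c , ≈-trans (≈-sym ew) eq , x , y , v , ≈-trans (≈-sym ez) exy , rest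
⟦⟧-solExt ρ ext (e ◇) w w' z z' ew ez (leafS .w .z eb eb') = leafS w' z' (≈-trans (≈-sym ew) eb) (≈-trans (≈-sym ez) eb')
⟦⟧-solExt ρ ext (e ◇) w w' z z' ew ez (nodeS .w .z u c x v y eq s a sd exy) =
  nodeS w' z' u c x v y (≈-trans (≈-sym ew) eq) s a sd (≈-trans (≈-sym ez) exy)

module _ {n : ℕ} (ρ : Fin n → Problem) (ext : ∀ a → SolExt (ρ a)) where

  private
    solExt : ∀ e → SolExt (⟦ e ⟧ ρ)
    solExt = ⟦⟧-solExt ρ ext

  ≤W-sound : ∀ {e f : RegE n} → n ⊢ e ≤ f → ⟦ e ⟧ ρ ≤W ⟦ f ⟧ ρ
  ≤W-sound refl≤ = ≤W-refl
  ≤W-sound (trans≤ d₁ d₂) = ≤W-trans (≤W-sound d₁) (≤W-sound d₂)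
  ≤W-sound zero≤ = 𝟘P-least
  ≤W-sound ≤top = ⊤P-greatest
  ≤W-sound (inl≤ {a}) = ⊔P-upperˡ (solExt a)
  ≤W-sound (inr≤ {b = b}) = ⊔P-upperʳ (solExt b)
  ≤W-sound (join≤ d₁ d₂) = ⊔P-least (≤W-sound d₁) (≤W-sound d₂)
  ≤W-sound meetl = ⊓P-lowerˡ
  ≤W-sound meetr = ⊓P-lowerʳ
  ≤W-sound (meet≤ {b = b} {c} d₁ d₂) = ⊓P-greatest (solExt b) (solExt c) (≤W-sound d₁) (≤W-sound d₂)
  ≤W-sound distr = ⊓P-distribˡ-⊔P
  ≤W-sound unitr₁ = ⋆P-identityʳ-≤
  ≤W-sound (unitr₂ {a}) = ⋆P-identityʳ-≥ (solExt a)
  ≤W-sound unitl₁ = ⋆P-identityˡ-≤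
  ≤W-sound (unitl₂ {a}) = ⋆P-identityˡ-≥ (solExt a)
  ≤W-sound (assoc₁ {c = c}) = ⋆P-assoc⁻¹ (solExt c)
  ≤W-sound (assoc₂ {b = b} {c}) = ⋆P-assoc (solExt b) (solExt c)
  ≤W-sound (mono⋆ {a' = a'} {b'} d₁ d₂) = ⋆P-mono (solExt a') (solExt b') (≤W-sound d₁) (≤W-sound d₂)
  ≤W-sound annih = ⋆P-zeroʳ
  ≤W-sound top⋆ = ⋆P-topʳ
  ≤W-sound distr⋆ = ⋆P-distribˡ-⊔P
  ≤W-sound (meet⋆ {b = b} {c}) = ⋆P-distribˡ-⊓P (solExt b) (solExt c)
  ≤W-sound (exch {b = b}) = ⋆P-⊓P-exchange (solExt b)
  ≤W-sound unit◇ = ◇P-unit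
  ≤W-sound unfold◇ = ◇P-unfold
  ≤W-sound (ind◇ {b = b} {c} d) = ◇P-induction (solExt b) (solExt c) (≤W-sound d)

lemma2p5 : (n : ℕ) (e f : RegE n) → n ⊢ e ≤ f →
    (ρ : Fin n → Problem) → (∀ a → Extensional (ρ a)) →
    ⟦ e ⟧ ρ ≤W ⟦ f ⟧ ρ
lemma2p5 n e f d ρ ext = ≤W-sound ρ (λ a → proj₂ (ext a)) d
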